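{- Let $\Sigma$ be a countable set of $\mathcal{L}^{2}_{\Theta}$-sentences. Then for any $\mathcal{L}^{2}_{\Theta}$-sentence $\varphi$, $\Sigma\models\varphi$ implies $\Sigma\vdash\varphi$.
   Context: Fix a countable first-order vocabulary of predicate constants $P_0,P_1,\dots$ (with identity). Let $\Theta$ be a countable set of first-order formulas, each written $\theta(\overline{x},\overline{y})$ where $\overline{x}$ is a nonempty tuple of distinguished free variables (its length $l+1$ is the arity of $\theta$) and $\overline{y}$ lists the remaining free variables (parameters). Enumerate $\Theta$ as $\theta^{l+1}_n$ ($n,l\in\omega$), $l+1$ being the arity. The language $\mathcal{L}^{2}_{\Theta}$ is the second-order language over this vocabulary with first-order variables $x_0,x_1,\dots$ and, for each arity $l+1$, countably many second-order variables $V^{l+1}_m$; atomic formulas are the first-order ones together with $V^{l+1}_m(t_1,\dots,t_{l+1})$ and $V_m=V_n$ (same arity); formulas are built with $\neg,\wedge,\forall$ over both sorts (other connectives and $\exists$ defined as usual). Semantics: for a structure $\mathfrak{A}$ with domain $A$, $K^A_\Theta$ is the collection of all $B\subseteq A^k$ (all $k$) such that there is $\theta(\overline{x},\overline{y})\in\Theta$ with $\overline{x}$ of length $k$ and a sequence $\overline{e}$ of elements of $A$ with $B=\{\overline{d}:\mathfrak{A}\models\theta[\overline{d},\overline{e}]\}$. The pair $(\mathfrak{A},K^A_\Theta)$ is a standard structure; in it, second-order variables of arity $k$ range over the $k$-ary members of $K^A_\Theta$, and $V_m=V_n$ is interpreted as equality of relations. $\Sigma\models\varphi$ means every standard structure satisfying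 all sentences of $\Sigma$ satisfies $\varphi$. For a formula $\psi$, a second-order variable $V^{l+1}_m$ and $n\in\omega$, $\psi^{l+1,m}_n$ is obtained by replacing any expression $V^{l+1}_m(\overline{x})$ (not bound by a quantifier) in $\psi$ by $\theta^{l+1}_n(\overline{x},\overline{y})$ and prefixing the resulting formula with the string of quantifiers $\forall\overline{x}$. Proof system: any complete set of axioms for first-order logic, plus the schemata (A1) $\forall\overline{y}\,\exists V\,\forall\overline{x}\,(V(\overline{x})\leftrightarrow\theta(\overline{x},\overline{y}))$ for each $\theta(\overline{x},\overline{y})\in\Theta$; (A2) $\forall V_m,V_n(\forall\overline{x}(V_m(\overline{x})\leftrightarrow V_n(\overline{x}))\leftrightarrow V_m=V_n)$ (same arity); (A3) $\forall V_m,V_n(V_m=V_n\rightarrow(\psi\rightarrow\psi'))$ where $\psi'$ results from $\psi$ by replacing some occurrences of $V_m$ by $V_n$ (same arity); (A4) $\forall V_m\psi\rightarrow\psi(V_m/V_n)$ where $V_n$ is free for $V_m$ in $\psi$ (same arity); (A5) $\forall V_m(\psi\rightarrow\chi)\rightarrow(\psi\rightarrow\forall V_m\chi)$ where $V_m$ is not free in $\psi$; (A6) $\forall V^{l+1}_m\psi\rightarrow\psi^{l+1,m}_n$ for all $m,n$; and rules (R1) modus ponens; (R2) from $\psi$ infer $\forall V\psi$ and $\forall x\psi$; (R3) from $\chi\rightarrow\psi^{l+1,m}_0,\ \chi\rightarrow\psi^{l+1,m}_1,\dots$ infer $\chi\rightarrow\forall V^{l+1}_m\psi$. A deduction of $\psi$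 from $\Sigma$ is a countable sequence of formulas ending with $\psi$, each member of which is in $\Sigma$, an axiom, or obtained from previous members by one of (R1)–(R3); write $\Sigma\vdash\psi$. -}

module Defs where

open import Level using (0ℓ)
open import Data.Nat using (ℕ; zero; suc; _+_; _∸_; _≡ᵇ_; _<ᵇ_; _≟_)
open import Data.Bool using (Bool; true; false; if_then_else_; not; _∧_)
open import Data.Fin using (Fin; toℕ; splitAt)
open import Data.Vec using (Vec; map; tabulate; lookup)
open import Data.Vec.Relation.Binary.Pointwise.Inductive using (Pointwise)
import Data.Vec.Functional as VF
open import Data.Product using (Σ; _×_; _,_; proj₁; proj₂)
open import Data.Sum using (_⊎_; inj₁; inj₂)
open import Data.Empty using (⊥)
open import Relation.Nullary using (yes; no)
open import Relation.Binary.PropositionalEquality using (_≡_; refl)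

-- Conventions:
--  * first-order variables x_0,x_1,... are de Bruijn indices (ℕ);
--  * second-order variables of arity (suc k) are de Bruijn indices (ℕ),
--    one index space per arity;
--  * terms are variables (the vocabulary has only predicate constants);
--  * the vocabulary is given by the arity function  ar : ℕ → ℕ  of P_0,P_1,...

module _ (ar : ℕ → ℕ) where

  -- First-order formulas with n variables in scope (for the set Θ).
  data FO : ℕ → Set where
    rel  : ∀ {n} (i : ℕ) → Vec (Fin n) (ar i) → FO n
    eq   : ∀ {n} → Fin n → Fin n → FO n
    neg  : ∀ {n} → FO n → FO n
    and  : ∀ {n} → FO n → FO n → FO n
    all  : ∀ {n} → FO (suc n) → FO n

  -- An enumeration θ^{k+1}_n of Θ: for arity suc k and index n, a number p of
  -- parameters and a first-order formula in suc k + p variables; the first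
  -- suc k variables are the distinguished ones x̄, the last p are the
  -- parameters ȳ.
  Theta : Set
  Theta = (k n : ℕ) → Σ ℕ (λ p → FO (suc k + p))

  data Fm : Set where
    rel  : (i : ℕ) → Vec ℕ (ar i) → Fm
    eq   : ℕ → ℕ → Fm
    app  : (k m : ℕ) → Vec ℕ (suc k) → Fm            -- V^{k+1}_m(t̄)
    veq  : (k m m' : ℕ) → Fm
    neg  : Fm → Fm
    and  : Fm → Fm → Fm
    all  : Fm → Fm
    all2 : (k : ℕ) → Fm → Fm                         -- ∀V^{k+1} (binds SO index 0 of arity k+1)

  infixr 4 _⇒_
  _⇒_ : Fm → Fm → Fm
  φ ⇒ ψ = neg (and φ (neg ψ))

  _⇔_ : Fm → Fm → Fm
  φ ⇔ ψ = and (φ ⇒ ψ) (ψ ⇒ φ)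

  allN : ℕ → Fm → Fm
  allN zero φ = φ
  allN (suc n) φ = all (allN n φ)

  vars : (k : ℕ) → Vec ℕ (suc k)
  vars k = tabulate toℕ

  data AllLt (c : ℕ) : ∀ {n} → Vec ℕ n → Set where
    []  : AllLt c Vec.[]
    _∷_ : ∀ {n x} {xs : Vec ℕ n} → (x Data.Nat.< c) → AllLt c xs → AllLt c (x Vec.∷ xs)

  data Scope : ℕ → (ℕ → ℕ) → Fm → Set where
    rel  : ∀ {c s i ts} → AllLt c ts → Scope c s (rel i ts)
    eq   : ∀ {c s t u} → t Data.Nat.< c → u Data.Nat.< c → Scope c s (eq t u)
    app  : ∀ {c s k m ts} → m Data.Nat.< s k → AllLt c ts → Scope c s (app k m ts)
    veq  : ∀ {c s k m m'} → m Data.Nat.< s k → m' Data.Nat.< s k → Scope c s (veq k m m')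
    neg  : ∀ {c s φ} → Scope c s φ → Scope c s (neg φ)
    and  : ∀ {c s φ ψ} → Scope c s φ → Scope c s ψ → Scope c s (and φ ψ)
    all  : ∀ {c s φ} → Scope (suc c) s φ → Scope c s (all φ)
    all2 : ∀ {c s k φ} → Scope c (λ k' → if k ≡ᵇ k' then suc (s k') else s k') φ → Scope c s (all2 k φ)

  Sentence : Fm → Set
  Sentence φ = Scope 0 (λ _ → 0) φ

  ext : (ℕ → ℕ) → ℕ → ℕ
  ext f zero = zero
  ext f (suc i) = suc (f i)

  sub0 : ℕ → ℕ → ℕ
  sub0 t zero = t
  sub0 t (suc i) = i

  ren : (ℕ → ℕ) → Fm → Fm
  ren f (rel i ts) = rel i (map f ts)
  ren f (eq t u) = eq (f t) (f u)
  ren f (app k m ts) = app k m (map f ts)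
  ren f (veq k m m') = veq k m m'
  ren f (neg φ) = neg (ren f φ)
  ren f (and φ ψ) = and (ren f φ) (ren f ψ)
  ren f (all φ) = all (ren (ext f) φ)
  ren f (all2 k φ) = all2 k (ren f φ)

  ren2 : ℕ → (ℕ → ℕ) → Fm → Fm
  ren2 k f (rel i ts) = rel i ts
  ren2 k f (eq t u) = eq t u
  ren2 k f (app k' m ts) = app k' (if k ≡ᵇ k' then f m else m) ts
  ren2 k f (veq k' m m') = veq k' (if k ≡ᵇ k' then f m else m) (if k ≡ᵇ k' then f m' else m')
  ren2 k f (neg φ) = neg (ren2 k f φ)
  ren2 k f (and φ ψ) = and (ren2 k f φ) (ren2 k f ψ)
  ren2 k f (all φ) = all (ren2 k f φ)
  ren2 k f (all2 k' φ) = all2 k' (ren2 k (if k ≡ᵇ k' then ext f else f) φ)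

  extF : ∀ {n} → (Fin n → ℕ) → Fin (suc n) → ℕ
  extF g Fin.zero = zero
  extF g (Fin.suc i) = suc (g i)

  emb : ∀ {n} → (Fin n → ℕ) → FO n → Fm
  emb g (rel i ts) = rel i (map g ts)
  emb g (eq t u) = eq (g t) (g u)
  emb g (neg φ) = neg (emb g φ)
  emb g (and φ ψ) = and (emb g φ) (emb g ψ)
  emb g (all φ) = all (emb (extF g) φ)

  -- ψ^{k+1,m}_n : replace the second-order variable by θ^{k+1}_n and
  -- universally close over the parameters ȳ of θ.

  module _ (k p : ℕ) (θ : FO (suc k + p)) where

    -- free FO variables (≥ c) are shifted by p, to make room for the
    -- p new quantifiers ∀ȳ prefixed in front
    shiftAt : ℕ → ℕ → ℕ
    shiftAt c x = if x <ᵇ c then x else x + p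

    -- θ with distinguished variables sent along d and parameter b sent to
    -- the prefixed quantifier c + b
    θat : ℕ → (Fin (suc k) → ℕ) → Fm
    θat c d = emb g θ
      where
      g : Fin (suc k + p) → ℕ
      g i with splitAt (suc k) i
      ... | inj₁ a = d a
      ... | inj₂ b = c + toℕ b

    dec : ℕ → ℕ → ℕ
    dec j m = if m <ᵇ j then m else m ∸ 1

    -- one side of an equation between relation variables of arity suc k,
    -- evaluated at the tuple x_0..x_k (inside ∀x_0..x_k, at FO depth c')
    side : ℕ → ℕ → ℕ → Fm
    side c' j m = if m ≡ᵇ j then θat c' toℕ else app k (dec j m) (vars k)

    -- c = FO binder depth, j = current index of the substituted variable
    substV : ℕ → ℕ → Fm → Fm
    substV c j (rel i ts) = rel i (map (shiftAt c) ts)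
    substV c j (eq t u) = eq (shiftAt c t) (shiftAt c u)
    substV c j (app k' m ts) with k ≟ k'
    ... | yes refl = if m ≡ᵇ j then θat c (λ a → shiftAt c (lookup ts a))
                               else app k (dec j m) (map (shiftAt c) ts)
    ... | no _ = app k' m (map (shiftAt c) ts)
    substV c j (veq k' m m') = if (k ≡ᵇ k') ∧ ((m ≡ᵇ j) Data.Bool.∨ (m' ≡ᵇ j))
        then allN (suc k) (side (suc k + c) j m ⇔ side (suc k + c) j m')
        else veq k' (if k ≡ᵇ k' then dec j m else m) (if k ≡ᵇ k' then dec j m' else m')
    substV c j (neg φ) = neg (substV c j φ)
    substV c j (and φ ψ) = and (substV c j φ) (substV c j ψ)
    substV c j (all φ) = all (substV (suc c) j φ)
    substV c j (all2 k' φ) = all2 k' (substV c (if k ≡ᵇ k' then suc j else j) φ)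

  -- ψ^{k+1}_n for the SO variable bound by the outermost ∀V^{k+1} (index 0)
  inst : Theta → (k n : ℕ) → Fm → Fm
  inst Θ k n ψ = allN (proj₁ (Θ k n)) (substV k (proj₁ (Θ k n)) (proj₂ (Θ k n)) 0 0 ψ)

  -- propositional tautologies (prime formulas valued arbitrarily)
  tv : (Fm → Bool) → Fm → Bool
  tv v (neg φ) = not (tv v φ)
  tv v (and φ ψ) = tv v φ ∧ tv v ψ
  tv v φ = v φ

  Taut : Fm → Set
  Taut φ = ∀ (v : Fm → Bool) → tv v φ ≡ true

  RT : ℕ → ℕ → ℕ → ℕ → Set
  RT s t u u' = (u' ≡ u) ⊎ ((u ≡ s) × (u' ≡ t))

  data RAt (s t : ℕ) : Fm → Fm → Set where
    rel : ∀ {i ts ts'} → Pointwise (RT s t) ts ts' → RAt s t (rel i ts) (rel i ts')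
    eq  : ∀ {u v u' v'} → RT s t u u' → RT s t v v' → RAt s t (eq u v) (eq u' v')
    app : ∀ {k m ts ts'} → Pointwise (RT s t) ts ts' → RAt s t (app k m ts) (app k m ts')

  RV2 : ℕ → ℕ → ℕ → ℕ → Set
  RV2 a b m m' = (m' ≡ m) ⊎ ((m ≡ a) × (m' ≡ b))

  data RV (k : ℕ) : ℕ → ℕ → Fm → Fm → Set where
    rel  : ∀ {a b i ts} → RV k a b (rel i ts) (rel i ts)
    eq   : ∀ {a b t u} → RV k a b (eq t u) (eq t u)
    app≠ : ∀ {a b k' m ts} → RV k a b (app k' m ts) (app k' m ts)
    app  : ∀ {a b ts} → RV k a b (app k a ts) (app k b ts)
    veq≠ : ∀ {a b k' m m'} → RV k a b (veq k' m m') (veq k' m m')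
    veq  : ∀ {a b m m' n n'} → RV2 a b m n → RV2 a b m' n' → RV k a b (veq k m m') (veq k n n')
    neg  : ∀ {a b φ φ'} → RV k a b φ φ' → RV k a b (neg φ) (neg φ')
    and  : ∀ {a b φ φ' ψ ψ'} → RV k a b φ φ' → RV k a b ψ ψ' → RV k a b (and φ ψ) (and φ' ψ')
    all  : ∀ {a b φ φ'} → RV k a b φ φ' → RV k a b (all φ) (all φ')
    all2 : ∀ {a b k' φ φ'} → RV k (if k ≡ᵇ k' then suc a else a) (if k ≡ᵇ k' then suc b else b) φ φ'
           → RV k a b (all2 k' φ) (all2 k' φ')

  module _ (Θ : Theta) where

    -- variables of θ^{k+1}_n inside  ∀ȳ ∃V ∀x̄ (…) : x_a ↦ a, y_b ↦ suc k + b
    g : (k n : ℕ) → Fin (suc k + proj₁ (Θ k n)) → ℕ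
    g k n i with splitAt (suc k) i
    ... | inj₁ a = toℕ a
    ... | inj₂ b = suc k + toℕ b

    data Axiom : Fm → Set where
      -- a complete axiomatization of first-order logic with identity
      -- (Enderton's; generalization is rule R2)
      taut    : ∀ {φ} → Taut φ → Axiom φ
      q-inst  : ∀ φ t → Axiom (all φ ⇒ ren (sub0 t) φ)
      q-dist  : ∀ φ ψ → Axiom (all (φ ⇒ ψ) ⇒ (all φ ⇒ all ψ))
      q-vac   : ∀ φ → Axiom (φ ⇒ all (ren suc φ))
      eq-refl : ∀ t → Axiom (eq t t)
      eq-subst : ∀ {s t α α'} → RAt s t α α' → Axiom (eq s t ⇒ (α ⇒ α'))
      A1 : ∀ k n → Axiom (allN (proj₁ (Θ k n))
                   (neg (all2 k (neg (allN (suc k)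
                     (app k 0 (vars k) ⇔ emb (g k n) (proj₂ (Θ k n))))))))
      A2 : ∀ k → Axiom (all2 k (all2 k
                   (allN (suc k) (app k 1 (vars k) ⇔ app k 0 (vars k)) ⇔ veq k 1 0)))
      A3 : ∀ k {ψ ψ'} → RV k 1 0 ψ ψ' → Axiom (all2 k (all2 k (veq k 1 0 ⇒ (ψ ⇒ ψ'))))
      A4 : ∀ k n ψ → Axiom (all2 k ψ ⇒ ren2 k (sub0 n) ψ)
      A5 : ∀ k ψ χ → Axiom (all2 k (ren2 k suc ψ ⇒ χ) ⇒ (ψ ⇒ all2 k χ))
      A6 : ∀ k n ψ → Axiom (all2 k ψ ⇒ inst Θ k n ψ)

    -- deductions (well-founded, possibly infinitely branching, i.e. countable)
    data Deriv (Γ : Fm → Set) : Fm → Set where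
      hyp  : ∀ {φ} → Γ φ → Deriv Γ φ
      ax   : ∀ {φ} → Axiom φ → Deriv Γ φ
      mp   : ∀ {φ ψ} → Deriv Γ (φ ⇒ ψ) → Deriv Γ φ → Deriv Γ ψ
      gen1 : ∀ {φ} → Deriv Γ φ → Deriv Γ (all φ)
      gen2 : ∀ {φ} k → Deriv Γ φ → Deriv Γ (all2 k φ)
      omega : ∀ {χ ψ} k → ((n : ℕ) → Deriv Γ (χ ⇒ inst Θ k n ψ))
              → Deriv Γ (χ ⇒ all2 k ψ)

  record Structure : Set₁ where
    field
      A     : Set
      point : A                                  -- domains are nonempty
      P     : (i : ℕ) → Vec A (ar i) → Set

  module _ (𝔄 : Structure) where
    open Structure 𝔄

    _∷ᶠ_ : ∀ {n} → A → (Fin n → A) → Fin (suc n) → A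
    (a ∷ᶠ ρ) Fin.zero = a
    (a ∷ᶠ ρ) (Fin.suc i) = ρ i

    satFO : ∀ {n} → (Fin n → A) → FO n → Set
    satFO ρ (rel i ts) = P i (map ρ ts)
    satFO ρ (eq t u) = ρ t ≡ ρ u
    satFO ρ (neg φ) = satFO ρ φ → ⊥
    satFO ρ (and φ ψ) = satFO ρ φ × satFO ρ ψ
    satFO ρ (all φ) = (a : A) → satFO (a ∷ᶠ ρ) φ

    module _ (Θ : Theta) where

      -- a code for a member of K^A_Θ of arity suc k: θ^{k+1}_n with parameters ē
      KCode : ℕ → Set
      KCode k = Σ ℕ (λ n → Fin (proj₁ (Θ k n)) → A)

      Ext : ∀ {k} → KCode k → Vec A (suc k) → Set
      Ext {k} (n , e) d = satFO (lookup d VF.++ e) (proj₂ (Θ k n))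

      SEnv : Set
      SEnv = (k : ℕ) → ℕ → KCode k

      consK : ∀ {k} → KCode k → (ℕ → KCode k) → ℕ → KCode k
      consK R σ zero = R
      consK R σ (suc m) = σ m

      upd : (k : ℕ) → KCode k → SEnv → SEnv
      upd k R σ k' with k ≟ k'
      ... | yes refl = consK R (σ k)
      ... | no _ = σ k'

      consA : A → (ℕ → A) → ℕ → A
      consA a ρ zero = a
      consA a ρ (suc i) = ρ i

      Sat : (ℕ → A) → SEnv → Fm → Set
      Sat ρ σ (rel i ts) = P i (map ρ ts)
      Sat ρ σ (eq t u) = ρ t ≡ ρ u
      Sat ρ σ (app k m ts) = Ext (σ k m) (map ρ ts)
      Sat ρ σ (veq k m m') =
        (d : Vec A (suc k)) → (Ext (σ k m) d → Ext (σ k m') d) × (Ext (σ k m') d → Ext (σ k m) d)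
      Sat ρ σ (neg φ) = Sat ρ σ φ → ⊥
      Sat ρ σ (and φ ψ) = Sat ρ σ φ × Sat ρ σ ψ
      Sat ρ σ (all φ) = (a : A) → Sat (consA a ρ) σ φ
      Sat ρ σ (all2 k φ) = (R : KCode k) → Sat ρ (upd k R σ) φ

      Models : Fm → Set
      Models φ = (ρ : ℕ → A) (σ : SEnv) → Sat ρ σ φ

  Entails : Theta → (Fm → Set) → Fm → Set₁
  Entails Θ Γ φ = (𝔄 : Structure) → ((ψ : Fm) → Γ ψ → Models 𝔄 Θ ψ) → Models 𝔄 Θ φ

{-# OPTIONS --safe #-}
-- Henkin's method. If Σ ⊬ φ, then ¬φ is consistent and, running through an
-- enumeration of all formulas, extends to a complete consistent theory T that
-- contains a witness ¬ψ(w) for every ¬∀x ψ and an instance ¬ψ^{k+1,m}_n for every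
-- ¬∀V ψ in it; the latter exists because of the ω-rule (R3). In the term model
-- of T, whose elements are the variables up to provable equality and whose
-- relation variables range over Θ-instances with such parameters, a formula holds
-- exactly when it belongs to T. This truth lemma is proved for simultaneous
-- substitutions of variables and Θ-instances, which is what the quantifier cases
-- need. The term model is then a standard model of Σ in which φ fails.
module Submission where

open import Defs renaming (_⇒_ to _⇒′_; _⇔_ to _⇔′_)
open import Level using (0ℓ)
open import Data.Nat using (ℕ; zero; suc; _+_; _≡ᵇ_; _<ᵇ_; _≟_; _<_; _≤_; _⊔_)
open import Data.Nat.Properties
open import Data.Bool using (Bool; true; false; if_then_else_; not; _∧_)
open import Data.Fin using (Fin; toℕ; splitAt) renaming (zero to fzero; suc to fsuc)
open import Data.Fin.Properties using (toℕ<n)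
open import Data.Vec using (Vec; []; _∷_; map; tabulate; lookup)
open import Data.Vec.Properties using (map-∘; map-cong; map-id; lookup-map; lookup∘tabulate; tabulate-cong; tabulate-∘)
import Data.Vec.Functional as VF
open import Data.Vec.Relation.Binary.Pointwise.Inductive as Pointwise using (Pointwise; []; _∷_)
open import Data.Product using (Σ; ∃; _×_; _,_; proj₁; proj₂)
open import Data.Product.Properties using (Σ-≡,≡→≡)
open import Data.Sum using (_⊎_; inj₁; inj₂; [_,_]; [_,_]′)
open import Data.Sum.Properties using ([,]-∘; [,]-cong)
open import Data.Empty using (⊥; ⊥-elim)
open import Function using (_∘_; id)
open import Relation.Nullary using (Dec; yes; no; ¬_)
open import Relation.Nullary.Decidable using (dec-no)
open import Relation.Binary.PropositionalEquality hiding ([_])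
open import Axiom.ExcludedMiddle using (ExcludedMiddle)
open import Axiom.DoubleNegationElimination using (em⇒dne)
open import Function.Bundles using (_⇔_; mk⇔; Equivalence)
import Function.Properties.Equivalence as ⇔
open import Function.Related.Propositional using (module EquationalReasoning; equivalence)
open import Function.Related.TypeIsomorphisms using (→-cong-⇔)
open import Data.Product.Function.NonDependent.Propositional using (_×-⇔_)

≡ᵇ-refl : ∀ k → (k ≡ᵇ k) ≡ true
≡ᵇ-refl zero = refl
≡ᵇ-refl (suc k) = ≡ᵇ-refl k

≢⇒≡ᵇ-false : ∀ {k k′} → k ≢ k′ → (k ≡ᵇ k′) ≡ false
≢⇒≡ᵇ-false {zero} {zero} k≢k′ = ⊥-elim (k≢k′ refl)
≢⇒≡ᵇ-false {zero} {suc k′} _ = refl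
≢⇒≡ᵇ-false {suc k} {zero} _ = refl
≢⇒≡ᵇ-false {suc k} {suc k′} k≢k′ = ≢⇒≡ᵇ-false (k≢k′ ∘ cong suc)

∘-++ : ∀ {A B : Set} {m n} (f : A → B) (xs : Fin m → A) (ys : Fin n → A) →
       f ∘ (xs VF.++ ys) ≗ (f ∘ xs) VF.++ (f ∘ ys)
∘-++ {m = m} f xs ys i = [,]-∘ f (splitAt m i)

++-cong : ∀ {A : Set} {m n} {xs xs′ : Fin m → A} {ys ys′ : Fin n → A} →
          xs ≗ xs′ → ys ≗ ys′ → xs VF.++ ys ≗ xs′ VF.++ ys′
++-cong {m = m} p q i = [,]-cong p q (splitAt m i)

Π-⇔ : ∀ {X : Set} {A B : X → Set} → (∀ x → A x ⇔ B x) → (∀ x → A x) ⇔ (∀ x → B x)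
Π-⇔ A⇔B = mk⇔ (λ a x → Equivalence.to (A⇔B x) (a x)) (λ b x → Equivalence.from (A⇔B x) (b x))

-- junk value 0 beyond q
extendFin : ∀ {q} → (Fin q → ℕ) → ℕ → ℕ
extendFin {zero} g x = 0
extendFin {suc q} g zero = g fzero
extendFin {suc q} g (suc x) = extendFin (g ∘ fsuc) x

extendFin-toℕ : ∀ {q} (g : Fin q → ℕ) b → extendFin g (toℕ b) ≡ g b
extendFin-toℕ g fzero = refl
extendFin-toℕ g (fsuc b) = extendFin-toℕ (g ∘ fsuc) b

-- Cantor's enumeration of ℕ × ℕ along the antidiagonals
next : ℕ × ℕ → ℕ × ℕ
next (a , zero) = 0 , suc a
next (a , suc b) = suc a , b

unpair : ℕ → ℕ × ℕ
unpair zero = 0 , 0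
unpair (suc c) = next (unpair c)

π₁ π₂ : ℕ → ℕ
π₁ = proj₁ ∘ unpair
π₂ = proj₂ ∘ unpair

unpair-onto : ∀ s a b → a + b ≡ s → ∃ λ c → unpair c ≡ (a , b)
unpair-onto s zero zero _ = 0 , refl
unpair-onto (suc s) zero (suc b) 1+b≡1+s with unpair-onto s b zero (trans (+-identityʳ b) (suc-injective 1+b≡1+s))
... | c , c↦ = suc c , cong next c↦
unpair-onto s (suc a) b a+b≡s with unpair-onto s a (suc b) (trans (+-suc a b) a+b≡s)
... | c , c↦ = suc c , cong next c↦

unpair-surjective : ∀ a b → ∃ λ c → π₁ c ≡ a × π₂ c ≡ b
unpair-surjective a b with unpair-onto (a + b) a b refl
... | c , c↦ = c , cong proj₁ c↦ , cong proj₂ c↦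

decodeVec : (q : ℕ) → ℕ → Vec ℕ q
decodeVec zero c = []
decodeVec (suc q) c = π₁ c ∷ decodeVec q (π₂ c)

decodeVec-surjective : ∀ {q} (xs : Vec ℕ q) → ∃ λ c → decodeVec q c ≡ xs
decodeVec-surjective [] = 0 , refl
decodeVec-surjective (x ∷ xs) with decodeVec-surjective xs
... | c , c↦xs with unpair-surjective x c
... | r , refl , refl = r , cong (π₁ r ∷_) c↦xs

Least : (ℕ → Set) → ℕ → Set
Least P m = P m × (∀ {j} → P j → m ≤ j)

least-below : ∀ {P : ℕ → Set} → (∀ j → Dec (P j)) → ∀ n → ∃ (Least P) ⊎ (∀ {j} → j < n → ¬ P j)
least-below P? zero = inj₂ λ ()
least-below P? (suc n) with least-below P? n
... | inj₁ found = inj₁ found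
... | inj₂ none with P? n
...   | yes p = inj₁ (n , p , λ pj → ≮⇒≥ (λ j<n → none j<n pj))
...   | no ¬p = inj₂ λ j<1+n → [ none , (λ { refl → ¬p }) ] (m<1+n⇒m<n∨m≡n j<1+n)

least : ∀ {P : ℕ → Set} → (∀ j → Dec (P j)) → ∀ {n} → P n → ∃ (Least P)
least P? {n} p with least-below P? (suc n)
... | inj₁ found = found
... | inj₂ none = ⊥-elim (none (n<1+n n) p)

module _ (ar : ℕ → ℕ) where

  infixr 4 _⇒_
  _⇒_ : Fm ar → Fm ar → Fm ar
  _⇒_ = _⇒′_ ar

  _⇔ᶠ_ : Fm ar → Fm ar → Fm ar
  _⇔ᶠ_ = _⇔′_ ar

  ext-cong : ∀ {f g} → f ≗ g → ext ar f ≗ ext ar g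
  ext-cong f≗g zero = refl
  ext-cong f≗g (suc x) = cong suc (f≗g x)

  ext-∘ : ∀ f g → ext ar f ∘ ext ar g ≗ ext ar (f ∘ g)
  ext-∘ f g zero = refl
  ext-∘ f g (suc x) = refl

  ren-cong : ∀ {f g} → f ≗ g → (φ : Fm ar) → ren ar f φ ≡ ren ar g φ
  ren-cong f≗g (rel i ts) = cong (rel i) (map-cong f≗g ts)
  ren-cong f≗g (eq t u) = cong₂ eq (f≗g t) (f≗g u)
  ren-cong f≗g (app k m ts) = cong (app k m) (map-cong f≗g ts)
  ren-cong f≗g (veq k m m′) = refl
  ren-cong f≗g (neg φ) = cong neg (ren-cong f≗g φ)
  ren-cong f≗g (and φ ψ) = cong₂ and (ren-cong f≗g φ) (ren-cong f≗g ψ)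
  ren-cong f≗g (all φ) = cong all (ren-cong (ext-cong f≗g) φ)
  ren-cong f≗g (all2 k φ) = cong (all2 k) (ren-cong f≗g φ)

  ren-∘ : ∀ f g (φ : Fm ar) → ren ar f (ren ar g φ) ≡ ren ar (f ∘ g) φ
  ren-∘ f g (rel i ts) = cong (rel i) (sym (map-∘ f g ts))
  ren-∘ f g (eq t u) = refl
  ren-∘ f g (app k m ts) = cong (app k m) (sym (map-∘ f g ts))
  ren-∘ f g (veq k m m′) = refl
  ren-∘ f g (neg φ) = cong neg (ren-∘ f g φ)
  ren-∘ f g (and φ ψ) = cong₂ and (ren-∘ f g φ) (ren-∘ f g ψ)
  ren-∘ f g (all φ) = cong all (trans (ren-∘ (ext ar f) (ext ar g) φ) (ren-cong (ext-∘ f g) φ))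
  ren-∘ f g (all2 k φ) = cong (all2 k) (ren-∘ f g φ)

  ren-id : ∀ {f} → f ≗ id → (φ : Fm ar) → ren ar f φ ≡ φ
  ren-id f≗id (rel i ts) = cong (rel i) (trans (map-cong f≗id ts) (map-id ts))
  ren-id f≗id (eq t u) = cong₂ eq (f≗id t) (f≗id u)
  ren-id f≗id (app k m ts) = cong (app k m) (trans (map-cong f≗id ts) (map-id ts))
  ren-id f≗id (veq k m m′) = refl
  ren-id f≗id (neg φ) = cong neg (ren-id f≗id φ)
  ren-id f≗id (and φ ψ) = cong₂ and (ren-id f≗id φ) (ren-id f≗id ψ)
  ren-id f≗id (all φ) = cong all (ren-id (λ { zero → refl ; (suc x) → cong suc (f≗id x) }) φ)
  ren-id f≗id (all2 k φ) = cong (all2 k) (ren-id f≗id φ)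

  vecBound : ∀ {q} → Vec ℕ q → ℕ
  vecBound [] = 0
  vecBound (x ∷ xs) = suc x ⊔ vecBound xs

  -- Bounds the free first-order variables; binders are not subtracted.
  varBound : Fm ar → ℕ
  varBound (rel i ts) = vecBound ts
  varBound (eq t u) = suc t ⊔ suc u
  varBound (app k m ts) = vecBound ts
  varBound (veq k m m′) = 0
  varBound (neg φ) = varBound φ
  varBound (and φ ψ) = varBound φ ⊔ varBound ψ
  varBound (all φ) = varBound φ
  varBound (all2 k φ) = varBound φ

  map-agree : ∀ {q} {f g : ℕ → ℕ} (ts : Vec ℕ q) → (∀ x → x < vecBound ts → f x ≡ g x) → map f ts ≡ map g ts
  map-agree [] _ = refl
  map-agree {f = f} {g} (x ∷ ts) f≈g =
    cong₂ _∷_ (f≈g x (m≤m⊔n (suc x) (vecBound ts)))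
              (map-agree {f = f} {g} ts (λ y y< → f≈g y (<-≤-trans y< (m≤n⊔m (suc x) (vecBound ts)))))

  ren-agree : ∀ {f g} (φ : Fm ar) → (∀ x → x < varBound φ → f x ≡ g x) → ren ar f φ ≡ ren ar g φ
  ren-agree (rel i ts) f≈g = cong (rel i) (map-agree ts f≈g)
  ren-agree (eq t u) f≈g = cong₂ eq (f≈g t (m≤m⊔n (suc t) (suc u))) (f≈g u (m≤n⊔m (suc t) (suc u)))
  ren-agree (app k m ts) f≈g = cong (app k m) (map-agree ts f≈g)
  ren-agree (veq k m m′) f≈g = refl
  ren-agree (neg φ) f≈g = cong neg (ren-agree φ f≈g)
  ren-agree {f} {g} (and φ ψ) f≈g =
    cong₂ and (ren-agree {f} {g} φ (λ x x< → f≈g x (<-≤-trans x< (m≤m⊔n (varBound φ) (varBound ψ)))))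
              (ren-agree {f} {g} ψ (λ x x< → f≈g x (<-≤-trans x< (m≤n⊔m (varBound φ) (varBound ψ)))))
  ren-agree (all φ) f≈g = cong all (ren-agree φ λ where
    zero _ → refl
    (suc x) x< → cong suc (f≈g x (<-trans (n<1+n x) x<)))
  ren-agree (all2 k φ) f≈g = cong (all2 k) (ren-agree φ f≈g)

  exts : ℕ → (ℕ → ℕ) → ℕ → ℕ
  exts zero f = f
  exts (suc q) f = exts q (ext ar f)

  exts-+ : ∀ q f y → exts q f (q + y) ≡ q + f y
  exts-+ zero f y = refl
  exts-+ (suc q) f y =
    trans (cong (exts q (ext ar f)) (sym (+-suc q y))) (trans (exts-+ q (ext ar f) (suc y)) (+-suc q (f y)))

  exts-< : ∀ q f {x} → x < q → exts q f x ≡ x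
  exts-< (suc q) f {x} x<1+q with m<1+n⇒m<n∨m≡n x<1+q
  ... | inj₁ x<q = exts-< q (ext ar f) x<q
  ... | inj₂ refl =
    trans (cong (exts x (ext ar f)) (sym (+-identityʳ x))) (trans (exts-+ x (ext ar f) 0) (+-identityʳ x))

  -- Removes q binders, instantiating bound variable i < q by f i.
  unbind : ℕ → (ℕ → ℕ) → ℕ → ℕ
  unbind zero f = id
  unbind (suc q) f = unbind q f ∘ exts q (sub0 ar (f q))

  unbind-+ : ∀ q f y → unbind q f (q + y) ≡ y
  unbind-+ zero f y = refl
  unbind-+ (suc q) f y = begin
    unbind q f (exts q (sub0 ar (f q)) (suc (q + y))) ≡⟨ cong (unbind q f ∘ exts q (sub0 ar (f q))) (sym (+-suc q y)) ⟩
    unbind q f (exts q (sub0 ar (f q)) (q + suc y))   ≡⟨ cong (unbind q f) (exts-+ q (sub0 ar (f q)) (suc y)) ⟩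
    unbind q f (q + y)                                ≡⟨ unbind-+ q f y ⟩
    y                                                 ∎
    where open ≡-Reasoning

  unbind-< : ∀ q f {x} → x < q → unbind q f x ≡ f x
  unbind-< (suc q) f {x} x<1+q with m<1+n⇒m<n∨m≡n x<1+q
  ... | inj₁ x<q = trans (cong (unbind q f) (exts-< q _ x<q)) (unbind-< q f x<q)
  ... | inj₂ refl = begin
    unbind x f (exts x (sub0 ar (f x)) x)       ≡⟨ cong (unbind x f ∘ exts x (sub0 ar (f x))) (sym (+-identityʳ x)) ⟩
    unbind x f (exts x (sub0 ar (f x)) (x + 0)) ≡⟨ cong (unbind x f) (exts-+ x (sub0 ar (f x)) 0) ⟩
    unbind x f (x + f x)                        ≡⟨ unbind-+ x f (f x) ⟩
    f x                                         ∎
    where open ≡-Reasoning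

  unbind-cong : ∀ q {f g} → (∀ {x} → x < q → f x ≡ g x) → unbind q f ≗ unbind q g
  unbind-cong zero f≈g x = refl
  unbind-cong (suc q) {f} {g} f≈g x =
    trans (cong (λ w → unbind q f (exts q (sub0 ar w) x)) (f≈g (n<1+n q)))
          (unbind-cong q (λ x<q → f≈g (<-trans x<q (n<1+n q))) _)

  map-vars : ∀ k {f} → (∀ {x} → x < suc k → f x ≡ x) → map f (vars ar k) ≡ vars ar k
  map-vars k {f} f≈id = trans (sym (tabulate-∘ f toℕ)) (tabulate-cong (λ a → f≈id (toℕ<n a)))

  ren-allN : ∀ q f (φ : Fm ar) → ren ar f (allN ar q φ) ≡ allN ar q (ren ar (exts q f) φ)
  ren-allN zero f φ = refl
  ren-allN (suc q) f φ = cong all (ren-allN q (ext ar f) φ)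

  -- An enumeration of all formulas

  mutual
    -- the first argument is fuel
    decode : ℕ → ℕ → Fm ar
    decode zero c = eq 0 0
    decode (suc l) c = node l (π₁ c) (π₂ c)

    -- Tag 0 retries with less fuel, so that raising the fuel loses no formula.
    node : ℕ → ℕ → ℕ → Fm ar
    node l 0 r = decode l r
    node l 1 r = neg (decode l r)
    node l 2 r = and (decode l (π₁ r)) (decode l (π₂ r))
    node l 3 r = all (decode l r)
    node l 4 r = all2 (π₁ r) (decode l (π₂ r))
    node l 5 r = rel (π₁ r) (decodeVec (ar (π₁ r)) (π₂ r))
    node l 6 r = eq (π₁ r) (π₂ r)
    node l 7 r = app (π₁ r) (π₁ (π₂ r)) (decodeVec (suc (π₁ r)) (π₂ (π₂ r)))
    node l _ r = veq (π₁ r) (π₁ (π₂ r)) (π₂ (π₂ r))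

  Decodes : Fm ar → ℕ → Set
  Decodes φ l = ∃ λ c → decode l c ≡ φ

  node-decodes : ∀ {φ l} t r → node l t r ≡ φ → Decodes φ (suc l)
  node-decodes {l = l} t r r↦φ with unpair-surjective t r
  ... | c , c↦t , c↦r = c , trans (cong₂ (node l) c↦t c↦r) r↦φ

  more-fuel : ∀ {φ l} d → Decodes φ l → Decodes φ (d + l)
  more-fuel zero φ↤ = φ↤
  more-fuel (suc d) φ↤ with more-fuel d φ↤
  ... | c , c↦φ = node-decodes 0 c c↦φ

  decode-surjective : ∀ (φ : Fm ar) → ∃ (Decodes φ)
  decode-surjective (rel i ts) with decodeVec-surjective ts
  ... | c , c↦ts with unpair-surjective i c
  ... | r , refl , refl = 1 , node-decodes 5 r (cong (rel (π₁ r)) c↦ts)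
  decode-surjective (eq t u) with unpair-surjective t u
  ... | r , refl , refl = 1 , node-decodes 6 r refl
  decode-surjective (app k m ts) with decodeVec-surjective ts
  ... | c , c↦ts with unpair-surjective m c
  ... | r′ , refl , refl with unpair-surjective k r′
  ... | r , refl , refl = 1 , node-decodes 7 r (cong (app (π₁ r) (π₁ (π₂ r))) c↦ts)
  decode-surjective (veq k m m′) with unpair-surjective m m′
  ... | r′ , refl , refl with unpair-surjective k r′
  ... | r , refl , refl = 1 , node-decodes 8 r refl
  decode-surjective (neg φ) with decode-surjective φ
  ... | l , c , c↦φ = suc l , node-decodes 1 c (cong neg c↦φ)
  decode-surjective (and φ ψ) with decode-surjective φ | decode-surjective ψ
  ... | l , φ↤ | l′ , ψ↤ with more-fuel l′ φ↤ | more-fuel l ψ↤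
  ... | c , c↦φ | c′ , c′↦ψ with unpair-surjective c c′
  ... | r , refl , refl =
    suc (l′ + l) , node-decodes 2 r (cong₂ and c↦φ (trans (cong (λ l″ → decode l″ (π₂ r)) (+-comm l′ l)) c′↦ψ))
  decode-surjective (all φ) with decode-surjective φ
  ... | l , c , c↦φ = suc l , node-decodes 3 c (cong all c↦φ)
  decode-surjective (all2 k φ) with decode-surjective φ
  ... | l , c , c↦φ with unpair-surjective k c
  ... | r , refl , refl = suc l , node-decodes 4 r (cong (all2 (π₁ r)) c↦φ)

  enum : ℕ → Fm ar
  enum c = decode (π₁ c) (π₂ c)

  enum-surjective : ∀ (φ : Fm ar) → ∃ λ s → enum s ≡ φ
  enum-surjective φ with decode-surjective φ
  ... | l , c , c↦φ with unpair-surjective l c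
  ... | s , refl , refl = s , c↦φ

  -- Simultaneous substitution of relation terms

  module _ (Θ : Theta ar) where

    params : ℕ → ℕ → ℕ
    params k n = proj₁ (Θ k n)

    body : (k n : ℕ) → FO ar (suc k + params k n)
    body k n = proj₂ (Θ k n)

    -- θ^{k+1}_n with first-order variables for its parameters ȳ
    Instance : ℕ → Set
    Instance k = Σ ℕ λ n → Vec ℕ (params k n)

    RelTerm : ℕ → Set
    RelTerm k = ℕ ⊎ Instance k

    RelSubst : Set
    RelSubst = (k : ℕ) → ℕ → RelTerm k

    _≐_ : RelSubst → RelSubst → Set
    σ ≐ σ′ = ∀ k m → σ k m ≡ σ′ k m

    instanceAt : (k : ℕ) → Instance k → (Fin (suc k) → ℕ) → Fm ar
    instanceAt k (n , ys) xs = emb ar (xs VF.++ lookup ys) (body k n)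

    appRel : (k : ℕ) → RelTerm k → Vec ℕ (suc k) → Fm ar
    appRel k (inj₁ m) ts = app k m ts
    appRel k (inj₂ c) ts = instanceAt k c (lookup ts)

    shiftRel : ∀ {k} → ℕ → RelTerm k → RelTerm k
    shiftRel q (inj₁ m) = inj₁ m
    shiftRel q (inj₂ (n , ys)) = inj₂ (n , map (q +_) ys)

    -- As in substV, an equation involving an instance becomes ∀x̄ (r x̄ ↔ r′ x̄).
    relExtEq : (k : ℕ) → RelTerm k → RelTerm k → Fm ar
    relExtEq k r r′ =
      allN ar (suc k) (appRel k (shiftRel (suc k) r) (vars ar k) ⇔ᶠ appRel k (shiftRel (suc k) r′) (vars ar k))

    relEq : (k : ℕ) → RelTerm k → RelTerm k → Fm ar
    relEq k (inj₁ m) (inj₁ m′) = veq k m m′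
    relEq k r r′ = relExtEq k r r′

    renRel : ∀ {k} → (ℕ → ℕ) → RelTerm k → RelTerm k
    renRel f (inj₁ m) = inj₁ (f m)
    renRel f (inj₂ c) = inj₂ c

    varRel : RelSubst
    varRel k m = inj₁ m

    weaken : RelSubst → RelSubst
    weaken σ k m = shiftRel 1 (σ k m)

    consVar : ∀ {k} → (ℕ → RelTerm k) → ℕ → RelTerm k
    consVar s zero = inj₁ 0
    consVar s (suc m) = renRel suc (s m)

    lift : ℕ → RelSubst → RelSubst
    lift k σ k′ with k ≟ k′
    ... | yes refl = consVar (σ k)
    ... | no _ = σ k′

    sub : (ℕ → ℕ) → RelSubst → Fm ar → Fm ar
    sub τ σ (rel i ts) = rel i (map τ ts)
    sub τ σ (eq t u) = eq (τ t) (τ u)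
    sub τ σ (app k m ts) = appRel k (σ k m) (map τ ts)
    sub τ σ (veq k m m′) = relEq k (σ k m) (σ k m′)
    sub τ σ (neg φ) = neg (sub τ σ φ)
    sub τ σ (and φ ψ) = and (sub τ σ φ) (sub τ σ ψ)
    sub τ σ (all φ) = all (sub (ext ar τ) (weaken σ) φ)
    sub τ σ (all2 k φ) = all2 k (sub τ (lift k σ) φ)

    lift-cong : ∀ k {σ σ′} → σ ≐ σ′ → lift k σ ≐ lift k σ′
    lift-cong k σ≐σ′ k′ m with k ≟ k′
    lift-cong k σ≐σ′ k′ zero | yes refl = refl
    lift-cong k σ≐σ′ k′ (suc m) | yes refl = cong (renRel suc) (σ≐σ′ k m)
    ... | no _ = σ≐σ′ k′ m

    sub-cong : ∀ {τ τ′ σ σ′} → τ ≗ τ′ → σ ≐ σ′ → (φ : Fm ar) → sub τ σ φ ≡ sub τ′ σ′ φ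
    sub-cong τ≗τ′ σ≐σ′ (rel i ts) = cong (rel i) (map-cong τ≗τ′ ts)
    sub-cong τ≗τ′ σ≐σ′ (eq t u) = cong₂ eq (τ≗τ′ t) (τ≗τ′ u)
    sub-cong τ≗τ′ σ≐σ′ (app k m ts) = cong₂ (appRel k) (σ≐σ′ k m) (map-cong τ≗τ′ ts)
    sub-cong τ≗τ′ σ≐σ′ (veq k m m′) = cong₂ (relEq k) (σ≐σ′ k m) (σ≐σ′ k m′)
    sub-cong τ≗τ′ σ≐σ′ (neg φ) = cong neg (sub-cong τ≗τ′ σ≐σ′ φ)
    sub-cong τ≗τ′ σ≐σ′ (and φ ψ) = cong₂ and (sub-cong τ≗τ′ σ≐σ′ φ) (sub-cong τ≗τ′ σ≐σ′ ψ)
    sub-cong τ≗τ′ σ≐σ′ (all φ) =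
      cong all (sub-cong (ext-cong τ≗τ′) (λ k m → cong (shiftRel 1) (σ≐σ′ k m)) φ)
    sub-cong τ≗τ′ σ≐σ′ (all2 k φ) = cong (all2 k) (sub-cong τ≗τ′ (lift-cong k σ≐σ′) φ)

    ren-as-sub : ∀ f (φ : Fm ar) → ren ar f φ ≡ sub f varRel φ
    ren-as-sub f (rel i ts) = refl
    ren-as-sub f (eq t u) = refl
    ren-as-sub f (app k m ts) = refl
    ren-as-sub f (veq k m m′) = refl
    ren-as-sub f (neg φ) = cong neg (ren-as-sub f φ)
    ren-as-sub f (and φ ψ) = cong₂ and (ren-as-sub f φ) (ren-as-sub f ψ)
    ren-as-sub f (all φ) = cong all (ren-as-sub (ext ar f) φ)
    ren-as-sub f (all2 k φ) = cong (all2 k) (trans (ren-as-sub f φ) (sub-cong (λ _ → refl) lift-varRel φ))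
      where
      lift-varRel : varRel ≐ lift k varRel
      lift-varRel k′ m with k ≟ k′
      lift-varRel k′ zero | yes refl = refl
      lift-varRel k′ (suc m) | yes refl = refl
      ... | no _ = refl

    emb-cong : ∀ {n} {f g : Fin n → ℕ} → f ≗ g → (θ : FO ar n) → emb ar f θ ≡ emb ar g θ
    emb-cong f≗g (rel i ts) = cong (rel i) (map-cong f≗g ts)
    emb-cong f≗g (eq t u) = cong₂ eq (f≗g t) (f≗g u)
    emb-cong f≗g (neg θ) = cong neg (emb-cong f≗g θ)
    emb-cong f≗g (and θ θ′) = cong₂ and (emb-cong f≗g θ) (emb-cong f≗g θ′)
    emb-cong f≗g (all θ) = cong all (emb-cong (λ { fzero → refl ; (fsuc i) → cong suc (f≗g i) }) θ)

    sub-emb : ∀ {n} τ σ (g : Fin n → ℕ) (θ : FO ar n) → sub τ σ (emb ar g θ) ≡ emb ar (τ ∘ g) θ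
    sub-emb τ σ g (rel i ts) = cong (rel i) (sym (map-∘ τ g ts))
    sub-emb τ σ g (eq t u) = refl
    sub-emb τ σ g (neg θ) = cong neg (sub-emb τ σ g θ)
    sub-emb τ σ g (and θ θ′) = cong₂ and (sub-emb τ σ g θ) (sub-emb τ σ g θ′)
    sub-emb τ σ g (all θ) =
      cong all (trans (sub-emb (ext ar τ) (weaken σ) (extF ar g) θ) (emb-cong (λ { fzero → refl ; (fsuc i) → refl }) θ))

    instanceAt-cong : ∀ {k} c {xs xs′} → xs ≗ xs′ → instanceAt k c xs ≡ instanceAt k c xs′
    instanceAt-cong {k} (n , ys) xs≗xs′ = emb-cong (++-cong xs≗xs′ (λ _ → refl)) (body k n)

    sub-instanceAt : ∀ {k} τ σ n ys xs → sub τ σ (instanceAt k (n , ys) xs) ≡ instanceAt k (n , map τ ys) (τ ∘ xs)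
    sub-instanceAt {k} τ σ n ys xs =
      trans (sub-emb τ σ _ (body k n))
            (emb-cong (λ i → trans (∘-++ τ xs (lookup ys) i) (++-cong (λ _ → refl) (λ b → sym (lookup-map b τ ys)) i))
                      (body k n))

    bindRel : ∀ {k} → (ℕ → ℕ) → (ℕ → RelTerm k) → RelTerm k → RelTerm k
    bindRel τ s (inj₁ m) = s m
    bindRel τ s (inj₂ (n , ys)) = inj₂ (n , map τ ys)

    compose : (ℕ → ℕ) → RelSubst → RelSubst → RelSubst
    compose τ σ₂ σ₁ k m = bindRel τ (σ₂ k) (σ₁ k m)

    sub-appRel : ∀ τ σ k r ts → sub τ σ (appRel k r ts) ≡ appRel k (bindRel τ (σ k) r) (map τ ts)
    sub-appRel τ σ k (inj₁ m) ts = refl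
    sub-appRel τ σ k (inj₂ (n , ys)) ts =
      trans (sub-instanceAt τ σ n ys (lookup ts)) (instanceAt-cong (n , map τ ys) (λ a → sym (lookup-map a τ ts)))

    weakenN : ℕ → RelSubst → RelSubst
    weakenN zero σ = σ
    weakenN (suc q) σ = weakenN q (weaken σ)

    weakenN-shift : ∀ q σ k m → weakenN q σ k m ≡ shiftRel q (σ k m)
    weakenN-shift zero σ k m with σ k m
    ... | inj₁ _ = refl
    ... | inj₂ (n , ys) = cong (λ ys′ → inj₂ (n , ys′)) (sym (map-id ys))
    weakenN-shift (suc q) σ k m with σ k m | weakenN-shift q (weaken σ) k m
    ... | inj₁ _ | eq₁ = eq₁
    ... | inj₂ (n , ys) | eq₁ =
      trans eq₁ (cong (λ ys′ → inj₂ (n , ys′)) (trans (sym (map-∘ (q +_) suc ys)) (map-cong (+-suc q) ys)))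

    sub-allN : ∀ q τ σ (φ : Fm ar) → sub τ σ (allN ar q φ) ≡ allN ar q (sub (exts q τ) (weakenN q σ) φ)
    sub-allN zero τ σ φ = refl
    sub-allN (suc q) τ σ φ = cong all (sub-allN q (ext ar τ) (weaken σ) φ)

    bindRel-shift : ∀ q τ σ k r → bindRel (exts q τ) (weakenN q σ k) (shiftRel q r) ≡ shiftRel q (bindRel τ (σ k) r)
    bindRel-shift q τ σ k (inj₁ m) = weakenN-shift q σ k m
    bindRel-shift q τ σ k (inj₂ (n , ys)) = cong (λ ys′ → inj₂ (n , ys′))
      (trans (sym (map-∘ (exts q τ) (q +_) ys)) (trans (map-cong (exts-+ q τ) ys) (map-∘ (q +_) τ ys)))

    sub-relExtEq : ∀ τ σ k r r′ → sub τ σ (relExtEq k r r′) ≡ relExtEq k (bindRel τ (σ k) r) (bindRel τ (σ k) r′)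
    sub-relExtEq τ σ k r r′ =
      trans (sub-allN (suc k) τ σ _) (cong (allN ar (suc k)) (cong₂ _⇔ᶠ_ (each-side r) (each-side r′)))
      where
      each-side : ∀ r → sub (exts (suc k) τ) (weakenN (suc k) σ) (appRel k (shiftRel (suc k) r) (vars ar k))
                   ≡ appRel k (shiftRel (suc k) (bindRel τ (σ k) r)) (vars ar k)
      each-side r = trans (sub-appRel (exts (suc k) τ) (weakenN (suc k) σ) k (shiftRel (suc k) r) (vars ar k))
                     (cong₂ (appRel k) (bindRel-shift (suc k) τ σ k r) (map-vars k (exts-< (suc k) τ)))

    relEq-inj₂ : ∀ k r c → relEq k r (inj₂ c) ≡ relExtEq k r (inj₂ c)
    relEq-inj₂ k (inj₁ _) c = refl
    relEq-inj₂ k (inj₂ _) c = refl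

    sub-relEq : ∀ τ σ k r r′ → sub τ σ (relEq k r r′) ≡ relEq k (bindRel τ (σ k) r) (bindRel τ (σ k) r′)
    sub-relEq τ σ k (inj₁ m) (inj₁ m′) = refl
    sub-relEq τ σ k (inj₁ m) (inj₂ c) = trans (sub-relExtEq τ σ k (inj₁ m) (inj₂ c)) (sym (relEq-inj₂ k (σ k m) _))
    sub-relEq τ σ k (inj₂ c) r′ = sub-relExtEq τ σ k (inj₂ c) r′

    weaken-compose : ∀ τ σ₂ σ₁ → weaken (compose τ σ₂ σ₁) ≐ compose (ext ar τ) (weaken σ₂) (weaken σ₁)
    weaken-compose τ σ₂ σ₁ k m with σ₁ k m
    ... | inj₁ _ = refl
    ... | inj₂ (n , ys) = cong (λ ys′ → inj₂ (n , ys′)) (trans (sym (map-∘ suc τ ys)) (map-∘ (ext ar τ) suc ys))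

    lift-compose : ∀ k τ σ₂ σ₁ → lift k (compose τ σ₂ σ₁) ≐ compose τ (lift k σ₂) (lift k σ₁)
    lift-compose k τ σ₂ σ₁ k′ m with k ≟ k′
    lift-compose k τ σ₂ σ₁ k′ zero | yes refl = refl
    lift-compose k τ σ₂ σ₁ k′ (suc m) | yes refl with σ₁ k m
    ... | inj₁ _ = refl
    ... | inj₂ _ = refl
    lift-compose k τ σ₂ σ₁ k′ m | no _ = refl

    sub-sub : ∀ (φ : Fm ar) τ₁ σ₁ τ₂ σ₂ →
              sub τ₂ σ₂ (sub τ₁ σ₁ φ) ≡ sub (τ₂ ∘ τ₁) (compose τ₂ σ₂ σ₁) φ
    sub-sub (rel i ts) τ₁ σ₁ τ₂ σ₂ = cong (rel i) (sym (map-∘ τ₂ τ₁ ts))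
    sub-sub (eq t u) τ₁ σ₁ τ₂ σ₂ = refl
    sub-sub (app k m ts) τ₁ σ₁ τ₂ σ₂ =
      trans (sub-appRel τ₂ σ₂ k (σ₁ k m) (map τ₁ ts))
            (cong (appRel k (bindRel τ₂ (σ₂ k) (σ₁ k m))) (sym (map-∘ τ₂ τ₁ ts)))
    sub-sub (veq k m m′) τ₁ σ₁ τ₂ σ₂ = sub-relEq τ₂ σ₂ k (σ₁ k m) (σ₁ k m′)
    sub-sub (neg φ) τ₁ σ₁ τ₂ σ₂ = cong neg (sub-sub φ τ₁ σ₁ τ₂ σ₂)
    sub-sub (and φ ψ) τ₁ σ₁ τ₂ σ₂ = cong₂ and (sub-sub φ τ₁ σ₁ τ₂ σ₂) (sub-sub ψ τ₁ σ₁ τ₂ σ₂)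
    sub-sub (all φ) τ₁ σ₁ τ₂ σ₂ = cong all (trans (sub-sub φ (ext ar τ₁) (weaken σ₁) (ext ar τ₂) (weaken σ₂))
      (sub-cong (ext-∘ τ₂ τ₁) (λ k m → sym (weaken-compose τ₂ σ₂ σ₁ k m)) φ))
    sub-sub (all2 k φ) τ₁ σ₁ τ₂ σ₂ = cong (all2 k) (trans (sub-sub φ τ₁ (lift k σ₁) τ₂ (lift k σ₂))
      (sub-cong (λ _ → refl) (λ k′ m → sym (lift-compose k τ₂ σ₂ σ₁ k′ m)) φ))

    ren-sub : ∀ f τ σ (φ : Fm ar) → ren ar f (sub τ σ φ) ≡ sub (f ∘ τ) (compose f varRel σ) φ
    ren-sub f τ σ φ = trans (ren-as-sub f _) (sub-sub φ τ σ f varRel)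

    map-fixed : ∀ {c q τ} {ts : Vec ℕ q} → (∀ {x} → x < c → τ x ≡ x) → AllLt ar c ts → map τ ts ≡ ts
    map-fixed τ≈id [] = refl
    map-fixed τ≈id (x< ∷ xs<) = cong₂ _∷_ (τ≈id x<) (map-fixed τ≈id xs<)

    sub-fixed : ∀ {c s τ σ} {φ : Fm ar} → Scope ar c s φ →
                (∀ {x} → x < c → τ x ≡ x) → (∀ k {m} → m < s k → σ k m ≡ inj₁ m) → sub τ σ φ ≡ φ
    sub-fixed (rel ts<) τ≈id σ≈var = cong (rel _) (map-fixed τ≈id ts<)
    sub-fixed (eq t< u<) τ≈id σ≈var = cong₂ eq (τ≈id t<) (τ≈id u<)
    sub-fixed (app {k = k} m< ts<) τ≈id σ≈var = cong₂ (appRel k) (σ≈var k m<) (map-fixed τ≈id ts<)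
    sub-fixed (veq {k = k} m< m′<) τ≈id σ≈var = cong₂ (relEq k) (σ≈var k m<) (σ≈var k m′<)
    sub-fixed (neg sc) τ≈id σ≈var = cong neg (sub-fixed sc τ≈id σ≈var)
    sub-fixed (and sc sc′) τ≈id σ≈var = cong₂ and (sub-fixed sc τ≈id σ≈var) (sub-fixed sc′ τ≈id σ≈var)
    sub-fixed {τ = τ} (all sc) τ≈id σ≈var = cong all (sub-fixed sc ext-fixed (λ k m< → cong (shiftRel 1) (σ≈var k m<)))
      where
      ext-fixed : ∀ {x} → x < suc _ → ext ar τ x ≡ x
      ext-fixed {zero} _ = refl
      ext-fixed {suc x} x< = cong suc (τ≈id (≤-pred x<))
    sub-fixed {s = s} {σ = σ} (all2 {k = k} sc) τ≈id σ≈var = cong (all2 k) (sub-fixed sc τ≈id lift-fixed)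
      where
      lift-fixed : ∀ k′ {m} → m < (if k ≡ᵇ k′ then suc (s k′) else s k′) → lift k σ k′ m ≡ inj₁ m
      lift-fixed k′ {m} m< with k ≟ k′
      lift-fixed k′ {zero} m< | yes refl = refl
      lift-fixed k′ {suc m} m< | yes refl rewrite ≡ᵇ-refl k = cong (renRel suc) (σ≈var k (≤-pred m<))
      ... | no k≢k′ rewrite ≢⇒≡ᵇ-false k≢k′ = σ≈var k′ m<

    sub-sentence : ∀ {φ : Fm ar} → Sentence ar φ → ∀ τ σ → sub τ σ φ ≡ φ
    sub-sentence sc τ σ = sub-fixed sc (λ ()) (λ k ())

    ren-sentence : ∀ {φ : Fm ar} → Sentence ar φ → ∀ τ → ren ar τ φ ≡ φ
    ren-sentence sc τ = trans (ren-as-sub τ _) (sub-sentence sc τ varRel)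

    module Instantiation (k n : ℕ) where
      private
        p = params k n
        θ = body k n

      -- the variables c, …, c + p − 1 bound by the prefix ∀ȳ of ψ^{k+1,m}_n
      paramVars : ℕ → Vec ℕ p
      paramVars c = tabulate ((c +_) ∘ toℕ)

      instSubst : ℕ → ℕ → RelSubst
      instSubst c j k′ m with k ≟ k′
      ... | yes refl = if m ≡ᵇ j then inj₂ (n , paramVars c) else inj₁ (dec ar k p θ j m)
      ... | no _ = inj₁ m

      shift : ℕ → ℕ → ℕ
      shift = shiftAt ar k p θ

      ext-shift : ∀ c → ext ar (shift c) ≗ shift (suc c)
      ext-shift c zero = refl
      ext-shift c (suc x) with x <ᵇ c
      ... | true = refl
      ... | false = refl

      weaken-instSubst : ∀ c j → weaken (instSubst c j) ≐ instSubst (suc c) j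
      weaken-instSubst c j k′ m with k ≟ k′
      ... | no _ = refl
      ... | yes refl with m ≡ᵇ j
      ... | true = cong (λ ys → inj₂ (n , ys)) (sym (tabulate-∘ suc ((c +_) ∘ toℕ)))
      ... | false = refl

      suc-dec : ∀ j m → (m ≡ᵇ j) ≡ false → suc (dec ar k p θ j m) ≡ dec ar k p θ (suc j) (suc m)
      suc-dec zero zero ()
      suc-dec (suc j) zero _ = refl
      suc-dec j (suc m) _ with suc m <ᵇ j
      ... | true = refl
      ... | false = refl

      lift-instSubst : ∀ c j → lift k (instSubst c j) ≐ instSubst c (suc j)
      lift-instSubst c j k′ m with k ≟ k′
      lift-instSubst c j k′ zero | yes refl = refl
      lift-instSubst c j k′ (suc m) | yes refl rewrite ≟-diag (refl {x = k}) with m ≡ᵇ j in m≢j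
      ... | true = refl
      ... | false = cong inj₁ (suc-dec j m m≢j)
      lift-instSubst c j k′ m | no k≢k′ rewrite dec-no (k ≟ k′) k≢k′ = refl

      lift-instSubst-≢ : ∀ c j {k′} → k ≢ k′ → lift k′ (instSubst c j) ≐ instSubst c j
      lift-instSubst-≢ c j {k′} k≢k′ k″ m with k′ ≟ k″
      ... | no _ = refl
      lift-instSubst-≢ c j {k′} k≢k′ k″ zero | yes refl rewrite dec-no (k ≟ k′) k≢k′ = refl
      lift-instSubst-≢ c j {k′} k≢k′ k″ (suc m) | yes refl rewrite dec-no (k ≟ k′) k≢k′ = refl

      -- θat's variable assignment is local to its where clause; it is read
      -- off the instance of an equation.
      θatVar : ℕ → (Fin (suc k) → ℕ) → Fin (suc k + p) → ℕ
      θatVar c d i with θat ar k p (eq i i) c d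
      ... | eq x _ = x
      ... | _ = 0

      θat-as-instanceAt : ∀ c d → θat ar k p θ c d ≡ instanceAt k (n , paramVars c) d
      θat-as-instanceAt c d = emb-cong assignment θ
        where
        assignment : θatVar c d ≗ d VF.++ lookup (paramVars c)
        assignment i with splitAt (suc k) i
        ... | inj₁ a = refl
        ... | inj₂ b = sym (lookup∘tabulate ((c +_) ∘ toℕ) b)

      θat-relExtEq : ∀ c →
        θat ar k p θ (suc k + c) toℕ ≡ instanceAt k (n , map (suc k +_) (paramVars c)) (lookup (vars ar k))
      θat-relExtEq c =
        trans (θat-as-instanceAt (suc k + c) toℕ)
              (trans (cong (λ ys → instanceAt k (n , ys) toℕ) shifted-params)
                     (instanceAt-cong (n , map (suc k +_) (paramVars c)) (λ a → sym (lookup∘tabulate toℕ a))))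
        where
        shifted-params : paramVars (suc k + c) ≡ map (suc k +_) (paramVars c)
        shifted-params = trans (tabulate-cong (λ b → +-assoc (suc k) c (toℕ b))) (tabulate-∘ (suc k +_) ((c +_) ∘ toℕ))

      substV-as-sub : ∀ (ψ : Fm ar) c j → substV ar k p θ c j ψ ≡ sub (shift c) (instSubst c j) ψ
      substV-as-sub (rel i ts) c j = refl
      substV-as-sub (eq t u) c j = refl
      substV-as-sub (app k′ m ts) c j with k ≟ k′
      ... | no _ = refl
      ... | yes refl with m ≡ᵇ j
      ... | true = trans (θat-as-instanceAt c _) (instanceAt-cong (n , paramVars c) (λ a → sym (lookup-map a (shift c) ts)))
      ... | false = refl
      substV-as-sub (veq k′ m m′) c j with k ≟ k′
      ... | no k≢k′ rewrite ≢⇒≡ᵇ-false k≢k′ = refl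
      ... | yes refl rewrite ≡ᵇ-refl k with m ≡ᵇ j | m′ ≡ᵇ j
      ... | true | true = cong (allN ar (suc k)) (cong₂ _⇔ᶠ_ (θat-relExtEq c) (θat-relExtEq c))
      ... | true | false = cong (allN ar (suc k)) (cong₂ _⇔ᶠ_ (θat-relExtEq c) refl)
      ... | false | true = cong (allN ar (suc k)) (cong₂ _⇔ᶠ_ refl (θat-relExtEq c))
      ... | false | false = refl
      substV-as-sub (neg ψ) c j = cong neg (substV-as-sub ψ c j)
      substV-as-sub (and ψ χ) c j = cong₂ and (substV-as-sub ψ c j) (substV-as-sub χ c j)
      substV-as-sub (all ψ) c j =
        cong all (trans (substV-as-sub ψ (suc c) j) (sym (sub-cong (ext-shift c) (weaken-instSubst c j) ψ)))
      substV-as-sub (all2 k′ ψ) c j with k ≟ k′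
      ... | yes refl rewrite ≡ᵇ-refl k =
        cong (all2 k) (trans (substV-as-sub ψ c (suc j)) (sym (sub-cong (λ _ → refl) (lift-instSubst c j) ψ)))
      ... | no k≢k′ rewrite ≢⇒≡ᵇ-false k≢k′ =
        cong (all2 k′) (trans (substV-as-sub ψ c j) (sym (sub-cong (λ _ → refl) (lift-instSubst-≢ c j k≢k′) ψ)))

      instBody : Fm ar → Fm ar
      instBody = sub (shift 0) (instSubst 0 0)

      inst-as-sub : ∀ ψ → inst ar Θ k n ψ ≡ allN ar p (instBody ψ)
      inst-as-sub ψ = cong (allN ar p) (substV-as-sub ψ 0 0)

      ren-instBody : ∀ τ ψ → ren ar (exts p τ) (instBody ψ) ≡ instBody (ren ar τ ψ)
      ren-instBody τ ψ = begin
        ren ar (exts p τ) (instBody ψ)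
          ≡⟨ ren-sub (exts p τ) (shift 0) (instSubst 0 0) ψ ⟩
        sub (exts p τ ∘ shift 0) (compose (exts p τ) varRel (instSubst 0 0)) ψ
          ≡⟨ sub-cong shift-commutes params-fixed ψ ⟩
        sub (shift 0 ∘ τ) (compose (shift 0) (instSubst 0 0) varRel) ψ
          ≡⟨ sym (sub-sub ψ τ varRel (shift 0) (instSubst 0 0)) ⟩
        instBody (sub τ varRel ψ)
          ≡⟨ cong instBody (sym (ren-as-sub τ ψ)) ⟩
        instBody (ren ar τ ψ) ∎
        where
        open ≡-Reasoning
        shift-commutes : exts p τ ∘ shift 0 ≗ shift 0 ∘ τ
        shift-commutes x = trans (cong (exts p τ) (+-comm x p)) (trans (exts-+ p τ x) (+-comm p (τ x)))
        params-fixed : compose (exts p τ) varRel (instSubst 0 0) ≐ compose (shift 0) (instSubst 0 0) varRel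
        params-fixed k′ m with k ≟ k′
        ... | no _ = refl
        ... | yes refl with m ≡ᵇ 0
        ... | true = cong (λ ys → inj₂ (n , ys))
                          (trans (sym (tabulate-∘ (exts p τ) toℕ)) (tabulate-cong (λ b → exts-< p τ (toℕ<n b))))
        ... | false = refl

      ren-inst : ∀ τ ψ → ren ar τ (inst ar Θ k n ψ) ≡ inst ar Θ k n (ren ar τ ψ)
      ren-inst τ ψ = begin
        ren ar τ (inst ar Θ k n ψ)                 ≡⟨ cong (ren ar τ) (inst-as-sub ψ) ⟩
        ren ar τ (allN ar p (instBody ψ))          ≡⟨ ren-allN p τ (instBody ψ) ⟩
        allN ar p (ren ar (exts p τ) (instBody ψ)) ≡⟨ cong (allN ar p) (ren-instBody τ ψ) ⟩
        allN ar p (instBody (ren ar τ ψ))          ≡⟨ sym (inst-as-sub (ren ar τ ψ)) ⟩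
        inst ar Θ k n (ren ar τ ψ)                 ∎
        where open ≡-Reasoning

    consRel : ∀ {k} → RelTerm k → (ℕ → RelTerm k) → ℕ → RelTerm k
    consRel r s zero = r
    consRel r s (suc m) = s m

    extendAt : (k : ℕ) → RelTerm k → RelSubst → RelSubst
    extendAt k r σ k′ with k ≟ k′
    ... | yes refl = consRel r (σ k)
    ... | no _ = σ k′

    ren-sub0-weaken : ∀ w τ σ (φ : Fm ar) →
                      ren ar (sub0 ar w) (sub (ext ar τ) (weaken σ) φ) ≡ sub (sub0 ar w ∘ ext ar τ) σ φ
    ren-sub0-weaken w τ σ φ = trans (ren-sub (sub0 ar w) (ext ar τ) (weaken σ) φ) (sub-cong (λ _ → refl) unshift φ)
      where
      unshift : compose (sub0 ar w) varRel (weaken σ) ≐ σ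
      unshift k m with σ k m
      ... | inj₁ _ = refl
      ... | inj₂ (n , ys) = cong (λ ys′ → inj₂ (n , ys′)) (trans (sym (map-∘ (sub0 ar w) suc ys)) (map-id ys))

    unbind-instBody : ∀ k n f τ σ (φ : Fm ar) →
      ren ar (unbind (params k n) f) (Instantiation.instBody k n (sub τ (lift k σ) φ))
        ≡ sub τ (extendAt k (inj₂ (n , tabulate (f ∘ toℕ))) σ) φ
    unbind-instBody k n f τ σ φ = begin
      ren ar U (instBody (sub τ (lift k σ) φ))
        ≡⟨ cong (ren ar U) (sub-sub φ τ (lift k σ) (shift 0) (instSubst 0 0)) ⟩
      ren ar U (sub (shift 0 ∘ τ) (compose (shift 0) (instSubst 0 0) (lift k σ)) φ)
        ≡⟨ ren-sub U (shift 0 ∘ τ) _ φ ⟩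
      sub (U ∘ shift 0 ∘ τ) (compose U varRel (compose (shift 0) (instSubst 0 0) (lift k σ))) φ
        ≡⟨ sub-cong (unbind-shift ∘ τ) extended φ ⟩
      sub τ (extendAt k (inj₂ (n , tabulate (f ∘ toℕ))) σ) φ ∎
      where
      open ≡-Reasoning
      open Instantiation k n
      U = unbind (params k n) f
      unbind-shift : ∀ y → U (shift 0 y) ≡ y
      unbind-shift y = trans (cong U (+-comm y (params k n))) (unbind-+ (params k n) f y)
      params-restored : ∀ {k′} n′ ys →
                        bindRel U (varRel k′) (bindRel (shift 0) (instSubst 0 0 k′) (inj₂ (n′ , ys))) ≡ inj₂ (n′ , ys)
      params-restored n′ ys = cong (λ ys′ → inj₂ (n′ , ys′))
        (trans (sym (map-∘ U (shift 0) ys)) (trans (map-cong unbind-shift ys) (map-id ys)))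
      extended : compose U varRel (compose (shift 0) (instSubst 0 0) (lift k σ))
                 ≐ extendAt k (inj₂ (n , tabulate (f ∘ toℕ))) σ
      extended k′ m with k ≟ k′
      extended k′ zero | yes refl = cong (λ ys → inj₂ (n , ys))
        (trans (sym (tabulate-∘ U toℕ)) (tabulate-cong (λ b → unbind-< (params k n) f (toℕ<n b))))
      extended k′ (suc m) | yes refl with σ k m
      ... | inj₁ _ = refl
      ... | inj₂ (n′ , ys) = params-restored n′ ys
      extended k′ m | no k≢k′ with σ k′ m
      ... | inj₁ _ = refl
      ... | inj₂ (n′ , ys) = params-restored n′ ys

    unbind-appRel : ∀ k f r →
      ren ar (unbind (suc k) f) (appRel k (shiftRel (suc k) r) (vars ar k)) ≡ appRel k r (tabulate (f ∘ toℕ))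
    unbind-appRel k f (inj₁ m) = cong (app k m) (trans (sym (tabulate-∘ U toℕ)) (tabulate-cong unbind-toℕ))
      where
      U = unbind (suc k) f
      unbind-toℕ : ∀ a → U (toℕ a) ≡ f (toℕ a)
      unbind-toℕ a = unbind-< (suc k) f (toℕ<n a)
    unbind-appRel k f (inj₂ (n , ys)) = begin
      ren ar U (instanceAt k (n , map (suc k +_) ys) (lookup (vars ar k)))
        ≡⟨ ren-as-sub U _ ⟩
      sub U varRel (instanceAt k (n , map (suc k +_) ys) (lookup (vars ar k)))
        ≡⟨ sub-instanceAt U varRel n (map (suc k +_) ys) (lookup (vars ar k)) ⟩
      instanceAt k (n , map U (map (suc k +_) ys)) (U ∘ lookup (vars ar k))
        ≡⟨ cong (λ ys′ → instanceAt k (n , ys′) (U ∘ lookup (vars ar k))) params-restored ⟩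
      instanceAt k (n , ys) (U ∘ lookup (vars ar k))
        ≡⟨ instanceAt-cong (n , ys) args ⟩
      instanceAt k (n , ys) (lookup (tabulate (f ∘ toℕ))) ∎
      where
      open ≡-Reasoning
      U = unbind (suc k) f
      params-restored : map U (map (suc k +_) ys) ≡ ys
      params-restored = trans (sym (map-∘ U (suc k +_) ys)) (trans (map-cong (unbind-+ (suc k) f) ys) (map-id ys))
      args : ∀ a → U (lookup (vars ar k) a) ≡ lookup (tabulate (f ∘ toℕ)) a
      args a = trans (cong U (lookup∘tabulate toℕ a))
                     (trans (unbind-< (suc k) f (toℕ<n a)) (sym (lookup∘tabulate (f ∘ toℕ) a)))

    ren-sub0-emb : ∀ {N} w (h : Fin N → ℕ) (θ : FO ar (suc N)) →
                   ren ar (sub0 ar w) (emb ar (extF ar h) θ) ≡ emb ar (w VF.∷ h) θ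
    ren-sub0-emb w h θ =
      trans (ren-as-sub _ _)
            (trans (sub-emb (sub0 ar w) varRel (extF ar h) θ) (emb-cong (λ { fzero → refl ; (fsuc i) → refl }) θ))

    module _ (Γ : Fm ar → Set) (Γ-closed : ∀ ψ → Γ ψ → Sentence ar ψ) where

      infix 3 ⊢_
      ⊢_ : Fm ar → Set
      ⊢_ = Deriv ar Θ Γ

      _⇒ᵇ_ : Bool → Bool → Bool
      a ⇒ᵇ b = not (a ∧ not b)

      table₁ : ∀ {f : Bool → Bool} → f true ≡ true → f false ≡ true → ∀ a → f a ≡ true
      table₁ t _ true = t
      table₁ _ f false = f

      table₂ : ∀ {f : Bool → Bool → Bool} → f true true ≡ true → f true false ≡ true →
               f false true ≡ true → f false false ≡ true → ∀ a b → f a b ≡ true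
      table₂ tt tf ft ff true = table₁ tt tf
      table₂ tt tf ft ff false = table₁ ft ff

      table₃ : ∀ {f : Bool → Bool → Bool → Bool} →
               f true true true ≡ true → f true true false ≡ true →
               f true false true ≡ true → f true false false ≡ true →
               f false true true ≡ true → f false true false ≡ true →
               f false false true ≡ true → f false false false ≡ true →
               ∀ a b c → f a b c ≡ true
      table₃ ttt ttf tft tff ftt ftf fft fff true = table₂ ttt ttf tft tff
      table₃ ttt ttf tft tff ftt ftf fft fff false = table₂ ftt ftf fft fff

      tautology : ∀ {φ} → Taut ar φ → ⊢ φ
      tautology t = ax (taut t)

      ¬¬-elim : ∀ A → ⊢ (neg (neg A) ⇒ A)
      ¬¬-elim A = tautology λ v → table₁ {λ a → not (not a) ⇒ᵇ a} refl refl (tv ar v A)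

      ⇒-refl : ∀ A → ⊢ (A ⇒ A)
      ⇒-refl A = tautology λ v → table₁ {λ a → a ⇒ᵇ a} refl refl (tv ar v A)

      taut-K : ∀ A B → ⊢ (A ⇒ (B ⇒ A))
      taut-K A B = tautology λ v → table₂ {λ a b → a ⇒ᵇ (b ⇒ᵇ a)} refl refl refl refl (tv ar v A) (tv ar v B)

      ∧-elimˡ : ∀ A B → ⊢ (and A B ⇒ A)
      ∧-elimˡ A B = tautology λ v → table₂ {λ a b → (a ∧ b) ⇒ᵇ a} refl refl refl refl (tv ar v A) (tv ar v B)

      ∧-elimʳ : ∀ A B → ⊢ (and A B ⇒ B)
      ∧-elimʳ A B = tautology λ v → table₂ {λ a b → (a ∧ b) ⇒ᵇ b} refl refl refl refl (tv ar v A) (tv ar v B)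

      ∧-intro : ∀ A B → ⊢ (A ⇒ (B ⇒ and A B))
      ∧-intro A B = tautology λ v → table₂ {λ a b → a ⇒ᵇ (b ⇒ᵇ (a ∧ b))} refl refl refl refl (tv ar v A) (tv ar v B)

      taut-refute : ∀ X A → ⊢ ((X ⇒ A) ⇒ ((X ⇒ neg A) ⇒ neg X))
      taut-refute X A = tautology λ v →
        table₂ {λ x a → (x ⇒ᵇ a) ⇒ᵇ ((x ⇒ᵇ not a) ⇒ᵇ not x)} refl refl refl refl (tv ar v X) (tv ar v A)

      taut-nand : ∀ X A → ⊢ (neg (and X A) ⇒ (X ⇒ neg A))
      taut-nand X A = tautology λ v →
        table₂ {λ x a → not (x ∧ a) ⇒ᵇ (x ⇒ᵇ not a)} refl refl refl refl (tv ar v X) (tv ar v A)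

      taut-self-refute : ∀ X B → ⊢ ((and X (neg B) ⇒ B) ⇒ neg (and X (neg B)))
      taut-self-refute X B = tautology λ v →
        table₂ {λ x b → ((x ∧ not b) ⇒ᵇ b) ⇒ᵇ not (x ∧ not b)} refl refl refl refl (tv ar v X) (tv ar v B)

      taut-S : ∀ X A B → ⊢ ((X ⇒ (A ⇒ B)) ⇒ ((X ⇒ A) ⇒ (X ⇒ B)))
      taut-S X A B = tautology λ v → table₃ {λ x a b → (x ⇒ᵇ (a ⇒ᵇ b)) ⇒ᵇ ((x ⇒ᵇ a) ⇒ᵇ (x ⇒ᵇ b))}
        refl refl refl refl refl refl refl refl (tv ar v X) (tv ar v A) (tv ar v B)

      taut-trans : ∀ X Y Z → ⊢ ((X ⇒ Y) ⇒ ((Y ⇒ Z) ⇒ (X ⇒ Z)))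
      taut-trans X Y Z = tautology λ v → table₃ {λ x y z → (x ⇒ᵇ y) ⇒ᵇ ((y ⇒ᵇ z) ⇒ᵇ (x ⇒ᵇ z))}
        refl refl refl refl refl refl refl refl (tv ar v X) (tv ar v Y) (tv ar v Z)

      mp₂ : ∀ {A B C} → ⊢ (A ⇒ (B ⇒ C)) → ⊢ A → ⊢ B → ⊢ C
      mp₂ d a b = mp (mp d a) b

      ⇒-trans : ∀ {X Y Z} → ⊢ (X ⇒ Y) → ⊢ (Y ⇒ Z) → ⊢ (X ⇒ Z)
      ⇒-trans {X} {Y} {Z} = mp₂ (taut-trans X Y Z)

      ⇒-weaken : ∀ {X A} → ⊢ A → ⊢ (X ⇒ A)
      ⇒-weaken {X} {A} = mp (taut-K A X)

      ⇒-mp : ∀ {X A B} → ⊢ (X ⇒ (A ⇒ B)) → ⊢ (X ⇒ A) → ⊢ (X ⇒ B)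
      ⇒-mp {X} {A} {B} = mp₂ (taut-S X A B)

      Consistent : Fm ar → Set
      Consistent χ = ¬ (⊢ neg χ)

      tv-ren : ∀ τ v (φ : Fm ar) → tv ar v (ren ar τ φ) ≡ tv ar (v ∘ ren ar τ) φ
      tv-ren τ v (rel i ts) = refl
      tv-ren τ v (eq t u) = refl
      tv-ren τ v (app k m ts) = refl
      tv-ren τ v (veq k m m′) = refl
      tv-ren τ v (neg φ) = cong not (tv-ren τ v φ)
      tv-ren τ v (and φ ψ) = cong₂ _∧_ (tv-ren τ v φ) (tv-ren τ v ψ)
      tv-ren τ v (all φ) = refl
      tv-ren τ v (all2 k φ) = refl

      RT-ren : ∀ τ {s t u u′} → RT ar s t u u′ → RT ar (τ s) (τ t) (τ u) (τ u′)
      RT-ren τ (inj₁ u′≡u) = inj₁ (cong τ u′≡u)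
      RT-ren τ (inj₂ (u≡s , u′≡t)) = inj₂ (cong τ u≡s , cong τ u′≡t)

      RAt-ren : ∀ τ {s t} {α α′ : Fm ar} → RAt ar s t α α′ → RAt ar (τ s) (τ t) (ren ar τ α) (ren ar τ α′)
      RAt-ren τ (rel rts) = rel (Pointwise.map⁺ (RT-ren τ) rts)
      RAt-ren τ (eq ru rv) = eq (RT-ren τ ru) (RT-ren τ rv)
      RAt-ren τ (app rts) = app (Pointwise.map⁺ (RT-ren τ) rts)

      RV-ren : ∀ τ {k a b} {φ φ′ : Fm ar} → RV ar k a b φ φ′ → RV ar k a b (ren ar τ φ) (ren ar τ φ′)
      RV-ren τ rel = rel
      RV-ren τ eq = eq
      RV-ren τ app≠ = app≠
      RV-ren τ app = app
      RV-ren τ veq≠ = veq≠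
      RV-ren τ (veq rm rm′) = veq rm rm′
      RV-ren τ (neg r) = neg (RV-ren τ r)
      RV-ren τ (and r r′) = and (RV-ren τ r) (RV-ren τ r′)
      RV-ren τ (all r) = all (RV-ren (ext ar τ) r)
      RV-ren τ (all2 r) = all2 (RV-ren τ r)

      ren-ren2 : ∀ τ k f (φ : Fm ar) → ren ar τ (ren2 ar k f φ) ≡ ren2 ar k f (ren ar τ φ)
      ren-ren2 τ k f (rel i ts) = refl
      ren-ren2 τ k f (eq t u) = refl
      ren-ren2 τ k f (app k′ m ts) = refl
      ren-ren2 τ k f (veq k′ m m′) = refl
      ren-ren2 τ k f (neg φ) = cong neg (ren-ren2 τ k f φ)
      ren-ren2 τ k f (and φ ψ) = cong₂ and (ren-ren2 τ k f φ) (ren-ren2 τ k f ψ)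
      ren-ren2 τ k f (all φ) = cong all (ren-ren2 (ext ar τ) k f φ)
      ren-ren2 τ k f (all2 k′ φ) = cong (all2 k′) (ren-ren2 τ k _ φ)

      exts-exts : ∀ p q f → exts q (exts p f) ≡ exts (p + q) f
      exts-exts zero q f = refl
      exts-exts (suc p) q f = exts-exts p q (ext ar f)

      ren-A1 : ∀ τ k n →
        let φ = allN ar (params k n) (neg (all2 k (neg (allN ar (suc k)
                  (app k 0 (vars ar k) ⇔ᶠ emb ar (g ar Θ k n) (body k n))))))
        in ren ar τ φ ≡ φ
      ren-A1 τ k n =
        trans (ren-allN p τ _)
              (cong (λ φ → allN ar p (neg (all2 k (neg φ))))
                    (trans (ren-allN (suc k) (exts p τ) _)
                           (cong (allN ar (suc k)) (cong₂ _⇔ᶠ_ (cong (app k 0) (map-vars k (fixed ∘ <-below))) emb-fixed))))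
        where
        p = params k n
        F = exts (suc k) (exts p τ)
        fixed : ∀ {x} → x < suc k + p → F x ≡ x
        fixed {x} x< =
          trans (cong (λ f → f x) (exts-exts p (suc k) τ)) (exts-< (p + suc k) τ (subst (x <_) (+-comm (suc k) p) x<))
        <-below : ∀ {x} → x < suc k → x < suc k + p
        <-below x< = <-≤-trans x< (m≤m+n (suc k) p)
        g< : ∀ i → g ar Θ k n i < suc k + p
        g< i with splitAt (suc k) i
        ... | inj₁ a = <-below (toℕ<n a)
        ... | inj₂ b = +-monoʳ-< (suc k) (toℕ<n b)
        emb-fixed : ren ar F (emb ar (g ar Θ k n) (body k n)) ≡ emb ar (g ar Θ k n) (body k n)
        emb-fixed = trans (ren-as-sub F _) (trans (sub-emb F varRel _ (body k n)) (emb-cong (fixed ∘ g<) (body k n)))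

      ren-A2 : ∀ τ k →
        let φ = all2 k (all2 k (allN ar (suc k) (app k 1 (vars ar k) ⇔ᶠ app k 0 (vars ar k)) ⇔ᶠ veq k 1 0))
        in ren ar τ φ ≡ φ
      ren-A2 τ k = cong (λ φ → all2 k (all2 k (φ ⇔ᶠ veq k 1 0)))
        (trans (ren-allN (suc k) τ _)
               (cong (allN ar (suc k)) (cong₂ _⇔ᶠ_ (cong (app k 1) vars-fixed) (cong (app k 0) vars-fixed))))
        where
        vars-fixed = map-vars k (exts-< (suc k) τ)

      ren-axiom : ∀ τ {φ} → Axiom ar Θ φ → ⊢ ren ar τ φ
      ren-axiom τ (taut {φ} t) = tautology λ v → trans (tv-ren τ v φ) (t (v ∘ ren ar τ))
      ren-axiom τ (q-inst φ t) = subst (λ ψ → ⊢ (all (ren ar (ext ar τ) φ) ⇒ ψ)) (sym commute) (ax (q-inst _ (τ t)))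
        where
        commute : ren ar τ (ren ar (sub0 ar t) φ) ≡ ren ar (sub0 ar (τ t)) (ren ar (ext ar τ) φ)
        commute = trans (ren-∘ τ (sub0 ar t) φ)
                        (trans (ren-cong (λ { zero → refl ; (suc x) → refl }) φ) (sym (ren-∘ (sub0 ar (τ t)) (ext ar τ) φ)))
      ren-axiom τ (q-dist φ ψ) = ax (q-dist _ _)
      ren-axiom τ (q-vac φ) = subst (λ ψ → ⊢ (ren ar τ φ ⇒ all ψ)) (sym commute) (ax (q-vac _))
        where
        commute : ren ar (ext ar τ) (ren ar suc φ) ≡ ren ar suc (ren ar τ φ)
        commute = trans (ren-∘ (ext ar τ) suc φ) (sym (ren-∘ suc τ φ))
      ren-axiom τ (eq-refl t) = ax (eq-refl (τ t))
      ren-axiom τ (eq-subst r) = ax (eq-subst (RAt-ren τ r))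
      ren-axiom τ (A1 k n) = subst ⊢_ (sym (ren-A1 τ k n)) (ax (A1 k n))
      ren-axiom τ (A2 k) = subst ⊢_ (sym (ren-A2 τ k)) (ax (A2 k))
      ren-axiom τ (A3 k r) = ax (A3 k (RV-ren τ r))
      ren-axiom τ (A4 k n ψ) =
        subst (λ χ → ⊢ (all2 k (ren ar τ ψ) ⇒ χ)) (sym (ren-ren2 τ k (sub0 ar n) ψ)) (ax (A4 k n _))
      ren-axiom τ (A5 k ψ χ) =
        subst (λ φ → ⊢ (all2 k (φ ⇒ ren ar τ χ) ⇒ (ren ar τ ψ ⇒ all2 k (ren ar τ χ))))
              (sym (ren-ren2 τ k suc ψ)) (ax (A5 k _ _))
      ren-axiom τ (A6 k n ψ) =
        subst (λ χ → ⊢ (all2 k (ren ar τ ψ) ⇒ χ)) (sym (Instantiation.ren-inst k n τ ψ)) (ax (A6 k n _))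

      ren-⊢ : ∀ τ {φ} → ⊢ φ → ⊢ ren ar τ φ
      ren-⊢ τ (hyp {φ} h) = subst ⊢_ (sym (ren-sentence (Γ-closed φ h) τ)) (hyp h)
      ren-⊢ τ (ax a) = ren-axiom τ a
      ren-⊢ τ (mp d e) = mp (ren-⊢ τ d) (ren-⊢ τ e)
      ren-⊢ τ (gen1 d) = gen1 (ren-⊢ (ext ar τ) d)
      ren-⊢ τ (gen2 k d) = gen2 k (ren-⊢ τ d)
      ren-⊢ τ (omega {χ} {ψ} k ds) =
        omega k λ n → subst (λ φ → ⊢ (ren ar τ χ ⇒ φ)) (Instantiation.ren-inst k n τ ψ) (ren-⊢ τ (ds n))

      fresh-to-0 : ℕ → ℕ → ℕ
      fresh-to-0 w x = if x ≡ᵇ w then 0 else suc x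

      -- Renaming w to 0 and every other x to x + 1 turns the deduction into one under a new binder.
      generalize-fresh : ∀ {X A} w → varBound X ≤ w → varBound A ≤ w →
                         ⊢ (X ⇒ ren ar (sub0 ar w) A) → ⊢ (X ⇒ all A)
      generalize-fresh {X} {A} w X≤w A≤w d =
        ⇒-trans (ax (q-vac X)) (mp (ax (q-dist (ren ar suc X) A)) (gen1 under-binder))
        where
        below-w : ∀ {x} → x < w → fresh-to-0 w x ≡ suc x
        below-w {x} x<w rewrite ≢⇒≡ᵇ-false (<⇒≢ x<w) = refl
        X-shifted : ren ar (fresh-to-0 w) X ≡ ren ar suc X
        X-shifted = ren-agree X (λ x x< → below-w (<-≤-trans x< X≤w))
        A-restored : ren ar (fresh-to-0 w) (ren ar (sub0 ar w) A) ≡ A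
        A-restored = trans (ren-∘ (fresh-to-0 w) (sub0 ar w) A) (trans (ren-agree A λ where
          zero _ → cong (if_then 0 else suc w) (≡ᵇ-refl w)
          (suc x) x< → below-w (<-≤-trans (<-trans (n<1+n x) x<) A≤w)) (ren-id (λ _ → refl) A))
        under-binder : ⊢ (ren ar suc X ⇒ A)
        under-binder = subst₂ (λ Y B → ⊢ (Y ⇒ B)) X-shifted A-restored (ren-⊢ (fresh-to-0 w) d)

      -- Henkin theories and their term models

      record HenkinTheory : Set₁ where
        field
          Th : Fm ar → Set
          Th-mp : ∀ {φ ψ} → Th (φ ⇒ ψ) → Th φ → Th ψ
          ⊢⇒Th : ∀ {φ} → ⊢ φ → Th φ
          Th-consistent : ∀ {φ} → Th φ → Th (neg φ) → ⊥
          Th-complete : ∀ φ → Th φ ⊎ Th (neg φ)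
          ∀-witness : ∀ {φ} → Th (neg (all φ)) → ∃ λ w → Th (neg (ren ar (sub0 ar w) φ))
          ∀²-witness : ∀ {k φ} → Th (neg (all2 k φ)) → ∃ λ n → Th (neg (inst ar Θ k n φ))

        open Equivalence using (to; from)

        Th-≡ : ∀ {φ ψ} → φ ≡ ψ → Th φ ⇔ Th ψ
        Th-≡ refl = ⇔.refl

        Th-dec : ∀ φ → Dec (Th φ)
        Th-dec φ with Th-complete φ
        ... | inj₁ t = yes t
        ... | inj₂ t = no (λ t′ → Th-consistent t′ t)

        Th-stable : ∀ {φ} → ¬ ¬ Th φ → Th φ
        Th-stable {φ} ¬¬t with Th-dec φ
        ... | yes t = t
        ... | no ¬t = ⊥-elim (¬¬t ¬t)

        Th-neg : ∀ {φ} → Th (neg φ) ⇔ (¬ Th φ)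
        Th-neg {φ} = mk⇔ (λ t t′ → Th-consistent t′ t) λ ¬t → [ ⊥-elim ∘ ¬t , id ]′ (Th-complete φ)

        Th-and : ∀ {φ ψ} → Th (and φ ψ) ⇔ (Th φ × Th ψ)
        Th-and {φ} {ψ} = mk⇔ (λ t → Th-mp (⊢⇒Th (∧-elimˡ φ ψ)) t , Th-mp (⊢⇒Th (∧-elimʳ φ ψ)) t)
                             (λ (t , t′) → Th-mp (Th-mp (⊢⇒Th (∧-intro φ ψ)) t) t′)

        Th-⇒ : ∀ {φ ψ} → Th (φ ⇒ ψ) ⇔ (Th φ → Th ψ)
        Th-⇒ = mk⇔ Th-mp λ f → from Th-neg λ t → let (tφ , t¬ψ) = to Th-and t in to Th-neg t¬ψ (f tφ)

        Th-⇔ᶠ : ∀ {φ ψ} → Th (φ ⇔ᶠ ψ) ⇔ ((Th φ → Th ψ) × (Th ψ → Th φ))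
        Th-⇔ᶠ = ⇔.trans Th-and (Th-⇒ ×-⇔ Th-⇒)

        Th-all : ∀ {φ} → Th (all φ) ⇔ (∀ w → Th (ren ar (sub0 ar w) φ))
        Th-all {φ} = mk⇔ (λ t w → Th-mp (⊢⇒Th (ax (q-inst φ w))) t)
          λ ts → Th-stable λ ¬t → let (w , t′) = ∀-witness (from Th-neg ¬t) in Th-consistent (ts w) t′

        Th-all2 : ∀ {k φ} → Th (all2 k φ) ⇔ (∀ n → Th (inst ar Θ k n φ))
        Th-all2 {k} {φ} = mk⇔ (λ t n → Th-mp (⊢⇒Th (ax (A6 k n φ))) t)
          λ ts → Th-stable λ ¬t → let (n , t′) = ∀²-witness (from Th-neg ¬t) in Th-consistent (ts n) t′

        Th-allN : ∀ q φ → Th (allN ar q φ) ⇔ (∀ f → Th (ren ar (unbind q f) φ))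
        Th-allN zero φ =
          mk⇔ (λ t _ → subst Th (sym (ren-id (λ _ → refl) φ)) t)
              (λ ts → subst Th (ren-id (λ _ → refl) φ) (ts (λ _ → 0)))
        Th-allN (suc q) φ = begin
          Th (all (allN ar q φ))
            ∼⟨ Th-all ⟩
          (∀ w → Th (ren ar (sub0 ar w) (allN ar q φ)))
            ∼⟨ Π-⇔ (λ w → Th-≡ (ren-allN q (sub0 ar w) φ)) ⟩
          (∀ w → Th (allN ar q (ren ar (exts q (sub0 ar w)) φ)))
            ∼⟨ Π-⇔ (λ w → Th-allN q _) ⟩
          (∀ w f → Th (ren ar (unbind q f) (ren ar (exts q (sub0 ar w)) φ)))
            ∼⟨ regroup ⟩
          (∀ f → Th (ren ar (unbind (suc q) f) φ)) ∎
          where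
          open EquationalReasoning {k = equivalence}
          _[q]≔_ : (ℕ → ℕ) → ℕ → ℕ → ℕ
          (f [q]≔ w) x = if x ≡ᵇ q then w else f x
          unbind-≔ : ∀ f w → unbind (suc q) (f [q]≔ w) ≗ unbind q f ∘ exts q (sub0 ar w)
          unbind-≔ f w x rewrite ≡ᵇ-refl q =
            unbind-cong q (λ {y} y<q → cong (if_then w else f y) (≢⇒≡ᵇ-false (<⇒≢ y<q))) _
          regroup : (∀ w f → Th (ren ar (unbind q f) (ren ar (exts q (sub0 ar w)) φ))) ⇔
                    (∀ f → Th (ren ar (unbind (suc q) f) φ))
          regroup = mk⇔ (λ ts f → subst Th (ren-∘ _ _ φ) (ts (f q) f))
                        (λ ts w f → subst Th (trans (ren-cong (unbind-≔ f w) φ) (sym (ren-∘ _ _ φ))) (ts (f [q]≔ w)))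

      module TermModel (H : HenkinTheory) where
        open HenkinTheory H
        open Equivalence using (to; from)

        infix 4 _≈_
        _≈_ : ℕ → ℕ → Set
        x ≈ y = Th (eq x y)

        Th-subst : ∀ {s t α α′} → s ≈ t → Th α → RAt ar s t α α′ → Th α′
        Th-subst s≈t tα r = Th-mp (Th-mp (⊢⇒Th (ax (eq-subst r))) s≈t) tα

        ≈-refl : ∀ x → x ≈ x
        ≈-refl x = ⊢⇒Th (ax (eq-refl x))

        ≈-sym : ∀ {x y} → x ≈ y → y ≈ x
        ≈-sym {x} x≈y = Th-subst x≈y (≈-refl x) (eq (inj₂ (refl , refl)) (inj₁ refl))

        ≈-trans : ∀ {x y z} → x ≈ y → y ≈ z → x ≈ z
        ≈-trans x≈y y≈z = Th-subst y≈z x≈y (eq (inj₁ refl) (inj₂ (refl , refl)))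

        splice : ∀ {q} → ℕ → Vec ℕ q → Vec ℕ q → Vec ℕ q
        splice zero xs ys = xs
        splice (suc m) [] [] = []
        splice (suc m) (x ∷ xs) (y ∷ ys) = y ∷ splice m xs ys

        splice-all : ∀ {q} (xs ys : Vec ℕ q) → splice q xs ys ≡ ys
        splice-all [] [] = refl
        splice-all (x ∷ xs) (y ∷ ys) = cong (y ∷_) (splice-all xs ys)

        splice-step : ∀ {q} m {xs ys : Vec ℕ q} → Pointwise _≈_ xs ys →
                      ∃ λ s → ∃ λ t → s ≈ t × Pointwise (RT ar s t) (splice m xs ys) (splice (suc m) xs ys)
        splice-step zero [] = 0 , 0 , ≈-refl 0 , []
        splice-step (suc m) [] = 0 , 0 , ≈-refl 0 , []
        splice-step zero {x ∷ _} {y ∷ _} (x≈y ∷ _) = x , y , x≈y , inj₂ (refl , refl) ∷ Pointwise.refl (inj₁ refl)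
        splice-step (suc m) (_ ∷ xs≈ys) with splice-step m xs≈ys
        ... | s , t , s≈t , step = s , t , s≈t , inj₁ refl ∷ step

        -- eq-subst replaces one variable at a time, so xs becomes ys one entry after another.
        Th-rel-cong : ∀ {i xs ys} → Pointwise _≈_ xs ys → Th (rel i xs) → Th (rel i ys)
        Th-rel-cong {i} {xs} {ys} xs≈ys t = subst (Th ∘ rel i) (splice-all xs ys) (spliced (ar i))
          where
          spliced : ∀ m → Th (rel i (splice m xs ys))
          spliced zero = t
          spliced (suc m) with splice-step m xs≈ys
          ... | s , t′ , s≈t′ , step = Th-subst s≈t′ (spliced m) (rel step)

        -- Opaque, so that unification never unfolds the search for the least representative.
        opaque
          rep : ℕ → ℕ
          rep x = proj₁ (least (λ j → Th-dec (eq j x)) (≈-refl x))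

          rep-≈ : ∀ x → rep x ≈ x
          rep-≈ x = proj₁ (proj₂ (least (λ j → Th-dec (eq j x)) (≈-refl x)))

          rep-≤ : ∀ {x j} → j ≈ x → rep x ≤ j
          rep-≤ {x} = proj₂ (proj₂ (least (λ j → Th-dec (eq j x)) (≈-refl x)))

        rep-cong : ∀ {x y} → x ≈ y → rep x ≡ rep y
        rep-cong {x} {y} x≈y = ≤-antisym (rep-≤ (≈-trans (rep-≈ y) (≈-sym x≈y))) (rep-≤ (≈-trans (rep-≈ x) x≈y))

        rep-injective : ∀ {x y} → rep x ≡ rep y → x ≈ y
        rep-injective {x} {y} e = ≈-trans (≈-sym (rep-≈ x)) (subst (_≈ y) (sym e) (rep-≈ y))

        -- the ≈-classes, each given by its least member
        Domain : Set
        Domain = Σ ℕ λ i → rep i ≡ i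

        cls : ℕ → Domain
        cls x = rep x , rep-cong (rep-≈ x)

        cls-proj₁ : ∀ a → cls (proj₁ a) ≡ a
        cls-proj₁ (i , rep-i≡i) = Σ-≡,≡→≡ (rep-i≡i , ≡-irrelevant _ _)

        cls-≡ : ∀ {x y} → (cls x ≡ cls y) ⇔ (x ≈ y)
        cls-≡ = mk⇔ (rep-injective ∘ cong proj₁) (λ x≈y → Σ-≡,≡→≡ (rep-cong x≈y , ≡-irrelevant _ _))

        𝔄 : Structure ar
        𝔄 = record { A = Domain ; point = cls 0 ; P = λ i ds → Th (rel i (map proj₁ ds)) }

        Represents : ∀ {X : Set} → (X → Domain) → (X → ℕ) → Set
        Represents ρ h = ∀ x → ρ x ≡ cls (h x)

        rel-truth : ∀ {X : Set} i (ts : Vec X (ar i)) {ρ h} → Represents ρ h →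
                    Th (rel i (map proj₁ (map ρ ts))) ⇔ Th (rel i (map h ts))
        rel-truth i ts {ρ} {h} ρ≈h = mk⇔ (Th-rel-cong (reps ts)) (Th-rel-cong (Pointwise.sym ≈-sym (reps ts)))
          where
          reps : ∀ {q} (ts : Vec _ q) → Pointwise _≈_ (map proj₁ (map ρ ts)) (map h ts)
          reps [] = []
          reps (t ∷ ts) = subst (_≈ h t) (sym (cong proj₁ (ρ≈h t))) (rep-≈ (h t)) ∷ reps ts

        eq-truth : ∀ {X : Set} {ρ h} → Represents {X} ρ h → ∀ t u → (ρ t ≡ ρ u) ⇔ (h t ≈ h u)
        eq-truth {h = h} ρ≈h t u = ⇔.trans (mk⇔ (λ e → trans (sym (ρ≈h t)) (trans e (ρ≈h u)))
                                        (λ e → trans (ρ≈h t) (trans e (sym (ρ≈h u)))))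
                                   (cls-≡ {h t} {h u})

        ¬-truth : ∀ {A : Set} {φ} → A ⇔ Th φ → (¬ A) ⇔ Th (neg φ)
        ¬-truth A⇔Th = ⇔.trans (→-cong-⇔ A⇔Th ⇔.refl) (⇔.sym Th-neg)

        ×-truth : ∀ {A B : Set} {φ ψ} → A ⇔ Th φ → B ⇔ Th ψ → (A × B) ⇔ Th (and φ ψ)
        ×-truth A⇔Th B⇔Th = ⇔.trans (A⇔Th ×-⇔ B⇔Th) (⇔.sym Th-and)

        ∀-elements : ∀ {P : Domain → Set} {Q : ℕ → Set} →
                     (∀ w a → a ≡ cls w → P a ⇔ Q w) → (∀ a → P a) ⇔ (∀ w → Q w)
        ∀-elements P⇔Q = mk⇔ (λ p w → to (P⇔Q w (cls w) refl) (p (cls w)))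
                             (λ q a → from (P⇔Q (proj₁ a) a (sym (cls-proj₁ a))) (q (proj₁ a)))

        FO-truth : ∀ {N} (θ : FO ar N) {ρ h} → Represents ρ h → satFO ar 𝔄 ρ θ ⇔ Th (emb ar h θ)
        FO-truth (rel i ts) ρ≈h = rel-truth i ts ρ≈h
        FO-truth (eq t u) ρ≈h = eq-truth ρ≈h t u
        FO-truth (neg θ) ρ≈h = ¬-truth (FO-truth θ ρ≈h)
        FO-truth (and θ θ′) ρ≈h = ×-truth (FO-truth θ ρ≈h) (FO-truth θ′ ρ≈h)
        FO-truth (all θ) {ρ} {h} ρ≈h = begin
          (∀ a → satFO ar 𝔄 (_∷ᶠ_ ar 𝔄 a ρ) θ)
            ∼⟨ ∀-elements (λ w a a≡ → FO-truth θ (cons-represents a≡)) ⟩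
          (∀ w → Th (emb ar (w VF.∷ h) θ))
            ∼⟨ Π-⇔ (λ w → Th-≡ (sym (ren-sub0-emb w h θ))) ⟩
          (∀ w → Th (ren ar (sub0 ar w) (emb ar (extF ar h) θ)))
            ∼⟨ ⇔.sym Th-all ⟩
          Th (all (emb ar (extF ar h) θ)) ∎
          where
          open EquationalReasoning {k = equivalence}
          cons-represents : ∀ {a w} → a ≡ cls w → Represents (_∷ᶠ_ ar 𝔄 a ρ) (w VF.∷ h)
          cons-represents a≡ fzero = a≡
          cons-represents a≡ (fsuc i) = ρ≈h i

        data Denotes {k} : RelTerm k → KCode ar 𝔄 Θ k → Set where
          denotes : ∀ {n ys e} → (∀ b → e b ≡ cls (lookup ys b)) → Denotes (inj₂ (n , ys)) (n , e)

        Denotes-extend : ∀ {k r R σ σM} → Denotes r R → (∀ k m → Denotes (σ k m) (σM k m)) →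
                         ∀ k′ m → Denotes (extendAt k r σ k′ m) (upd ar 𝔄 Θ k R σM k′ m)
        Denotes-extend {k} r≈R σ≈σM k′ m with k ≟ k′
        Denotes-extend r≈R σ≈σM k′ zero | yes refl = r≈R
        Denotes-extend r≈R σ≈σM k′ (suc m) | yes refl = σ≈σM k′ m
        ... | no _ = σ≈σM k′ m

        app-truth : ∀ {k r R} → Denotes r R → ∀ d ts → (∀ a → lookup d a ≡ cls (lookup ts a)) →
                    Ext ar 𝔄 Θ R d ⇔ Th (appRel k r ts)
        app-truth {k} (denotes {n} {ys} e≈ys) d ts d≈ts =
          FO-truth (body k n) λ i → trans (++-cong d≈ts e≈ys i) (sym (∘-++ cls (lookup ts) (lookup ys) i))

        ∀-tuples : ∀ {k} {P : Vec Domain (suc k) → Set} {Q : (ℕ → ℕ) → Set} →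
                   (∀ f d → (∀ a → lookup d a ≡ cls (lookup (tabulate (f ∘ toℕ)) a)) → P d ⇔ Q f) →
                   (∀ d → P d) ⇔ (∀ f → Q f)
        ∀-tuples P⇔Q = mk⇔
          (λ p f → to (P⇔Q f (tabulate (cls ∘ f ∘ toℕ)) λ a →
            trans (lookup∘tabulate (cls ∘ f ∘ toℕ) a) (cong cls (sym (lookup∘tabulate (f ∘ toℕ) a)))) (p _))
          (λ q d → let f = extendFin (proj₁ ∘ lookup d) in from (P⇔Q f d λ a →
            sym (trans (cong cls (trans (lookup∘tabulate (f ∘ toℕ) a) (extendFin-toℕ _ a))) (cls-proj₁ (lookup d a)))) (q f))

        ∀-codes : ∀ {k} {P : KCode ar 𝔄 Θ k → Set} {Q : ℕ → (ℕ → ℕ) → Set} →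
                  (∀ n f R → Denotes (inj₂ (n , tabulate (f ∘ toℕ))) R → P R ⇔ Q n f) →
                  (∀ R → P R) ⇔ (∀ n f → Q n f)
        ∀-codes P⇔Q = mk⇔
          (λ p n f → to (P⇔Q n f (n , cls ∘ f ∘ toℕ) (denotes λ b → cong cls (sym (lookup∘tabulate (f ∘ toℕ) b))))
                        (p _))
          (λ q (n , e) → let f = extendFin (proj₁ ∘ e) in from (P⇔Q n f (n , e) (denotes λ b →
            sym (trans (cong cls (trans (lookup∘tabulate (f ∘ toℕ) b) (extendFin-toℕ _ b))) (cls-proj₁ (e b))))) (q n f))

        veq-truth : ∀ {k r r′ R R′} → Denotes r R → Denotes r′ R′ →
                    (∀ d → (Ext ar 𝔄 Θ R d → Ext ar 𝔄 Θ R′ d) × (Ext ar 𝔄 Θ R′ d → Ext ar 𝔄 Θ R d)) ⇔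
                    Th (relEq k r r′)
        veq-truth {k} {r} {r′} r≈R@(denotes _) r′≈R′ = begin
          _ ∼⟨ ∀-tuples (λ f d d≈ → both (app-truth r≈R d (tab f) d≈) (app-truth r′≈R′ d (tab f) d≈)) ⟩
          (∀ f → (Th (appRel k r (tab f)) → Th (appRel k r′ (tab f))) ×
                 (Th (appRel k r′ (tab f)) → Th (appRel k r (tab f))))
            ∼⟨ Π-⇔ (λ f → ⇔.sym Th-⇔ᶠ) ⟩
          (∀ f → Th (appRel k r (tab f) ⇔ᶠ appRel k r′ (tab f)))
            ∼⟨ Π-⇔ (λ f → Th-≡ (sym (cong₂ _⇔ᶠ_ (unbind-appRel k f r) (unbind-appRel k f r′)))) ⟩
          (∀ f → Th (ren ar (unbind (suc k) f)
                       (appRel k (shiftRel (suc k) r) (vars ar k) ⇔ᶠ appRel k (shiftRel (suc k) r′) (vars ar k))))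
            ∼⟨ ⇔.sym (Th-allN (suc k) _) ⟩
          Th (relExtEq k r r′) ∎
          where
          open EquationalReasoning {k = equivalence}
          tab : (ℕ → ℕ) → Vec ℕ (suc k)
          tab f = tabulate (f ∘ toℕ)
          both : ∀ {A A′ B B′ : Set} → A ⇔ A′ → B ⇔ B′ →
                 ((A → B) × (B → A)) ⇔ ((A′ → B′) × (B′ → A′))
          both A⇔A′ B⇔B′ = →-cong-⇔ A⇔A′ B⇔B′ ×-⇔ →-cong-⇔ B⇔B′ A⇔A′

        truth : ∀ (φ : Fm ar) {τ σ ρ σM} → Represents ρ τ → (∀ k m → Denotes (σ k m) (σM k m)) →
                Sat ar 𝔄 Θ ρ σM φ ⇔ Th (sub τ σ φ)
        truth (rel i ts) ρ≈τ σ≈σM = rel-truth i ts ρ≈τ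
        truth (eq t u) ρ≈τ σ≈σM = eq-truth ρ≈τ t u
        truth (app k m ts) {τ} {ρ = ρ} ρ≈τ σ≈σM =
          app-truth (σ≈σM k m) (map ρ ts) (map τ ts) λ a →
            trans (lookup-map a ρ ts) (trans (ρ≈τ _) (cong cls (sym (lookup-map a τ ts))))
        truth (veq k m m′) ρ≈τ σ≈σM = veq-truth (σ≈σM k m) (σ≈σM k m′)
        truth (neg φ) ρ≈τ σ≈σM = ¬-truth (truth φ ρ≈τ σ≈σM)
        truth (and φ ψ) ρ≈τ σ≈σM = ×-truth (truth φ ρ≈τ σ≈σM) (truth ψ ρ≈τ σ≈σM)
        truth (all φ) {τ} {σ} {ρ} {σM} ρ≈τ σ≈σM = begin
          (∀ a → Sat ar 𝔄 Θ (consA ar 𝔄 Θ a ρ) σM φ)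
            ∼⟨ ∀-elements (λ w a a≡ → truth φ (cons-represents a≡) σ≈σM) ⟩
          (∀ w → Th (sub (sub0 ar w ∘ ext ar τ) σ φ))
            ∼⟨ Π-⇔ (λ w → Th-≡ (sym (ren-sub0-weaken w τ σ φ))) ⟩
          (∀ w → Th (ren ar (sub0 ar w) (sub (ext ar τ) (weaken σ) φ)))
            ∼⟨ ⇔.sym Th-all ⟩
          Th (all (sub (ext ar τ) (weaken σ) φ)) ∎
          where
          open EquationalReasoning {k = equivalence}
          cons-represents : ∀ {a w} → a ≡ cls w → Represents (consA ar 𝔄 Θ a ρ) (sub0 ar w ∘ ext ar τ)
          cons-represents a≡ zero = a≡
          cons-represents a≡ (suc x) = ρ≈τ x
        truth (all2 k φ) {τ} {σ} {ρ} {σM} ρ≈τ σ≈σM = begin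
          (∀ R → Sat ar 𝔄 Θ ρ (upd ar 𝔄 Θ k R σM) φ)
            ∼⟨ ∀-codes (λ n f R r≈R → truth φ ρ≈τ (Denotes-extend r≈R σ≈σM)) ⟩
          (∀ n f → Th (sub τ (extendAt k (inj₂ (n , tabulate (f ∘ toℕ))) σ) φ))
            ∼⟨ Π-⇔ (λ n → Π-⇔ (λ f → Th-≡ (sym (unbind-instBody k n f τ σ φ)))) ⟩
          (∀ n f → Th (ren ar (unbind (params k n) f) (Instantiation.instBody k n Ψ)))
            ∼⟨ Π-⇔ (λ n → ⇔.sym (Th-allN (params k n) _)) ⟩
          (∀ n → Th (allN ar (params k n) (Instantiation.instBody k n Ψ)))
            ∼⟨ Π-⇔ (λ n → Th-≡ (sym (Instantiation.inst-as-sub k n Ψ))) ⟩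
          (∀ n → Th (inst ar Θ k n Ψ))
            ∼⟨ ⇔.sym Th-all2 ⟩
          Th (all2 k Ψ) ∎
          where
          open EquationalReasoning {k = equivalence}
          Ψ = sub τ (lift k σ) φ

        sentence-truth : ∀ {φ} → Sentence ar φ → Th φ ⇔ Models ar 𝔄 Θ φ
        sentence-truth {φ} φ-closed = mk⇔ true-everywhere λ ⊨φ → true-somewhere (⊨φ cls λ k m → 0 , λ _ → cls 0)
          where
          code-denotes : ∀ {k} (R : KCode ar 𝔄 Θ k) → Denotes (inj₂ (proj₁ R , tabulate (proj₁ ∘ proj₂ R))) R
          code-denotes (n , e) = denotes λ b → sym (trans (cong cls (lookup∘tabulate (proj₁ ∘ e) b)) (cls-proj₁ (e b)))
          true-everywhere : Th φ → Models ar 𝔄 Θ φ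
          true-everywhere t ρ σM =
            from (truth φ {τ = proj₁ ∘ ρ} (λ x → sym (cls-proj₁ (ρ x))) (λ k m → code-denotes (σM k m)))
                 (subst Th (sym (sub-sentence φ-closed _ _)) t)
          true-somewhere : Sat ar 𝔄 Θ cls (λ k m → 0 , λ _ → cls 0) φ → Th φ
          true-somewhere s =
            subst Th (sub-sentence φ-closed _ _)
                  (to (truth φ {τ = id} {σ = λ k m → inj₂ (0 , tabulate λ _ → 0)} (λ _ → refl)
                             (λ k m → denotes λ b → cong cls (sym (lookup∘tabulate _ b))))
                      s)

      -- Lindenbaum's construction

      -- varBound (X ∧ ¬∀x A) is a variable fresh for both X and A.
      fresh-witness : ∀ {X A} → Consistent (and X (neg (all A))) →
        Consistent (and (and X (neg (all A))) (neg (ren ar (sub0 ar (varBound (and X (neg (all A))))) A)))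
      fresh-witness {X} {A} consistent ⊢X⇒A[w] =
        consistent (mp (taut-self-refute X (all A)) (generalize-fresh _ ≤-refl (m≤n⊔m (varBound X) (varBound A)) ⊢X⇒A[w]))

      -- If every instance were refutable, the ω-rule (R3) would refute ¬∀V A.
      omega-witness : ExcludedMiddle 0ℓ → ∀ {X k A} → Consistent (and X (neg (all2 k A))) →
        ∃ λ n → Consistent (and (and X (neg (all2 k A))) (neg (inst ar Θ k n A)))
      omega-witness em {X} {k} {A} consistent with em {∃ λ n → Consistent (and (and X (neg (all2 k A))) (neg (inst ar Θ k n A)))}
      ... | yes found = found
      ... | no none =
        ⊥-elim (consistent (mp (taut-self-refute X (all2 k A)) (omega k λ n → em⇒dne em λ ⊬ → none (n , ⊬))))

      data Shape : Fm ar → Set where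
        ¬∀ : ∀ A → Shape (neg (all A))
        ¬∀² : ∀ k A → Shape (neg (all2 k A))
        other : ∀ {ψ} → Shape ψ

      shape : ∀ ψ → Shape ψ
      shape (neg (all A)) = ¬∀ A
      shape (neg (all2 k A)) = ¬∀² k A
      shape ψ = other

      module Lindenbaum (em : ExcludedMiddle 0ℓ) (χ₀ : Fm ar) (χ₀-consistent : Consistent χ₀) where

        witnessed : ∀ χ {ψ} → Shape ψ → Consistent (and χ ψ) → Fm ar
        witnessed χ (¬∀ A) _ = and (and χ (neg (all A))) (neg (ren ar (sub0 ar (varBound (and χ (neg (all A))))) A))
        witnessed χ (¬∀² k A) c = and (and χ (neg (all2 k A))) (neg (inst ar Θ k (proj₁ (omega-witness em c)) A))
        witnessed χ {ψ} other _ = and χ ψ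

        witnessed-consistent : ∀ χ {ψ} (s : Shape ψ) c → Consistent (witnessed χ s c)
        witnessed-consistent χ (¬∀ A) c = fresh-witness c
        witnessed-consistent χ (¬∀² k A) c = proj₂ (omega-witness em c)
        witnessed-consistent χ other c = c

        witnessed-⇒ : ∀ χ {ψ} (s : Shape ψ) c → ⊢ (witnessed χ s c ⇒ and χ ψ)
        witnessed-⇒ χ (¬∀ A) c = ∧-elimˡ _ _
        witnessed-⇒ χ (¬∀² k A) c = ∧-elimˡ _ _
        witnessed-⇒ χ other c = ⇒-refl _

        extend : (χ ψ : Fm ar) → Dec (Consistent (and χ ψ)) → Fm ar
        extend χ ψ (yes c) = witnessed χ (shape ψ) c
        extend χ ψ (no _) = χ

        extend-⇒ : ∀ χ ψ d → ⊢ (extend χ ψ d ⇒ χ)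
        extend-⇒ χ ψ (yes c) = ⇒-trans (witnessed-⇒ χ (shape ψ) c) (∧-elimˡ χ ψ)
        extend-⇒ χ ψ (no _) = ⇒-refl χ

        extend-consistent : ∀ χ ψ d → Consistent χ → Consistent (extend χ ψ d)
        extend-consistent χ ψ (yes c) _ = witnessed-consistent χ (shape ψ) c
        extend-consistent χ ψ (no _) c = c

        extend-decides : ∀ χ ψ d → ⊢ (extend χ ψ d ⇒ ψ) ⊎ ⊢ (χ ⇒ neg ψ)
        extend-decides χ ψ (yes c) = inj₁ (⇒-trans (witnessed-⇒ χ (shape ψ) c) (∧-elimʳ χ ψ))
        extend-decides χ ψ (no ¬c) = inj₂ (mp (taut-nand χ ψ) (em⇒dne em ¬c))

        extend-¬∀ : ∀ χ ψ A → ψ ≡ neg (all A) → ∀ d → Consistent (and χ ψ) →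
                    ⊢ (extend χ ψ d ⇒ neg (ren ar (sub0 ar (varBound (and χ ψ))) A))
        extend-¬∀ χ _ A refl (yes c) _ = ∧-elimʳ _ _
        extend-¬∀ χ _ A refl (no ¬c) c = ⊥-elim (¬c c)

        extend-¬∀² : ∀ χ ψ k A → ψ ≡ neg (all2 k A) → ∀ d → Consistent (and χ ψ) →
                     ∃ λ n → ⊢ (extend χ ψ d ⇒ neg (inst ar Θ k n A))
        extend-¬∀² χ _ k A refl (yes c) _ = _ , ∧-elimʳ _ _
        extend-¬∀² χ _ k A refl (no ¬c) c = ⊥-elim (¬c c)

        stage : ℕ → Fm ar
        stage zero = χ₀
        stage (suc s) = extend (stage s) (enum s) em

        stage-consistent : ∀ s → Consistent (stage s)
        stage-consistent zero = χ₀-consistent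
        stage-consistent (suc s) = extend-consistent (stage s) (enum s) em (stage-consistent s)

        stage-decreasing : ∀ s d → ⊢ (stage (d + s) ⇒ stage s)
        stage-decreasing s zero = ⇒-refl (stage s)
        stage-decreasing s (suc d) = ⇒-trans (extend-⇒ _ _ em) (stage-decreasing s d)

        Th : Fm ar → Set
        Th ψ = ∃ λ s → ⊢ (stage s ⇒ ψ)

        common-stage : ∀ {φ ψ} → Th φ → Th ψ → ∃ λ s → ⊢ (stage s ⇒ φ) × ⊢ (stage s ⇒ ψ)
        common-stage {φ} {ψ} (s , d) (t , e) =
          t + s , ⇒-trans (stage-decreasing s t) d ,
          subst (λ u → ⊢ (stage u ⇒ ψ)) (+-comm s t) (⇒-trans (stage-decreasing t s) e)

        Th-mp : ∀ {φ ψ} → Th (φ ⇒ ψ) → Th φ → Th ψ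
        Th-mp t u = let (s , d , e) = common-stage t u in s , ⇒-mp d e

        ⊢⇒Th : ∀ {φ} → ⊢ φ → Th φ
        ⊢⇒Th d = 0 , ⇒-weaken d

        Th-consistent : ∀ {φ} → Th φ → Th (neg φ) → ⊥
        Th-consistent t u = let (s , d , e) = common-stage t u in stage-consistent s (mp₂ (taut-refute (stage s) _) d e)

        Th-complete : ∀ ψ → Th ψ ⊎ Th (neg ψ)
        Th-complete ψ with enum-surjective ψ
        ... | s , refl with extend-decides (stage s) (enum s) em
        ... | inj₁ d = inj₁ (suc s , d)
        ... | inj₂ d = inj₂ (s , d)

        consistent-with-stage : ∀ {ψ} s → Th ψ → Consistent (and (stage s) ψ)
        consistent-with-stage {ψ} s t d = Th-consistent t (s , mp (taut-nand (stage s) ψ) d)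

        Th-∀-witness : ∀ {A} → Th (neg (all A)) → ∃ λ w → Th (neg (ren ar (sub0 ar w) A))
        Th-∀-witness {A} t with enum-surjective (neg (all A))
        ... | s , e = _ , suc s , extend-¬∀ (stage s) (enum s) A e em (consistent-with-stage s (subst Th (sym e) t))

        Th-∀²-witness : ∀ {k A} → Th (neg (all2 k A)) → ∃ λ n → Th (neg (inst ar Θ k n A))
        Th-∀²-witness {k} {A} t with enum-surjective (neg (all2 k A))
        ... | s , e with extend-¬∀² (stage s) (enum s) k A e em (consistent-with-stage s (subst Th (sym e) t))
        ... | n , d = n , suc s , d

        henkin : HenkinTheory
        henkin = record
          { Th = Th
          ; Th-mp = Th-mp
          ; ⊢⇒Th = ⊢⇒Th
          ; Th-consistent = Th-consistent
          ; Th-complete = Th-complete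
          ; ∀-witness = Th-∀-witness
          ; ∀²-witness = Th-∀²-witness
          }

      model-existence : ExcludedMiddle 0ℓ → ∀ {χ} → Sentence ar χ → Consistent χ →
                        ∃ λ (𝔄 : Structure ar) → (∀ ψ → Γ ψ → Models ar 𝔄 Θ ψ) × Models ar 𝔄 Θ χ
      model-existence em {χ} χ-closed χ-consistent =
        𝔄 , (λ ψ γ → to (sentence-truth (Γ-closed ψ γ)) (⊢⇒Th (hyp γ))) ,
        to (sentence-truth χ-closed) (0 , ⇒-refl χ)
        where
        open Lindenbaum em χ χ-consistent
        open TermModel henkin
        open Equivalence

      completeness : ExcludedMiddle 0ℓ → ∀ {φ} → Sentence ar φ → Entails ar Θ Γ φ → ⊢ φ
      completeness em {φ} φ-closed Γ⊨φ = em⇒dne em λ ⊬φ →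
        let (𝔄 , 𝔄⊨Γ , 𝔄⊨¬φ) = model-existence em (neg φ-closed) (⊬φ ∘ mp (¬¬-elim φ))
            open Structure 𝔄
            ρ = λ _ → point
            σ = λ k m → 0 , λ _ → point
        in 𝔄⊨¬φ ρ σ (Γ⊨φ 𝔄 𝔄⊨Γ ρ σ)

mainTheorem5 : ExcludedMiddle 0ℓ →
    (ar : ℕ → ℕ) (Θ : Theta ar) (Σ : Fm ar → Set) →
    ((ψ : Fm ar) → Σ ψ → Sentence ar ψ) →
    (φ : Fm ar) → Sentence ar φ →
    Entails ar Θ Σ φ → Deriv ar Θ Σ φ
mainTheorem5 em ar Θ Σ Σ-closed φ φ-closed = completeness ar Θ Σ Σ-closed em φ-closed
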